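{- Let $\pi=a_1a_2\cdots a_n\in\mathfrak{S}_n$ ($n\ge 2$) be a separable permutation. Then: (i) If $a_1<a_n$, there is an integer $m$ with $1\le m<n$ such that, writing $\pi=\pi_A\pi_B$ with $\pi_A=a_1\cdots a_m$ and $\pi_B=a_{m+1}\cdots a_n$, $$F(V_\pi,q)=\begin{bmatrix}n\\ m\end{bmatrix}F(V_{\pi_A},q)\,F(V_{\pi_B},q).$$ (ii) If $a_1>a_n$, there is an integer $m$ with $1\le m<n$ such that, writing $\pi=\pi_A\pi_B$ with $\pi_A=a_1\cdots a_m$ and $\pi_B=a_{m+1}\cdots a_n$, $$F(V_\pi,q)=F(V_{\pi_A},q)\,F(V_{\pi_B},q).$$
   Context: $\mathfrak{S}_n$ is the symmetric group on $\{1,\dots,n\}$, permutations written in one-line notation $\pi=a_1\cdots a_n$; products are composed right-to-left. The length $\ell(\pi)=\#\{i<j: a_i>a_j\}$. Let $s_i=(i,i+1)$. The weak (Bruhat) order on $\mathfrak{S}_n$ is generated by cover relations $\pi\lessdot\sigma$ when $\sigma=\pi s_i$ for some $i$ and $\ell(\sigma)>\ell(\pi)$. $w_0=n(n-1)\cdots 1$ is the maximum. For $\pi\in\mathfrak{S}_n$, $V_\pi=[\pi,w_0]$ in weak order, graded with $\pi$ of rank $0$, and $F(V_\pi,q)=\sum_{v\in V_\pi}q^{\ell(v)-\ell(\pi)}$. A permutation is separable if it is 3142-avoiding and 2413-avoiding (no $i<j<k<h$ with $a_j<a_h<a_i<a_k$ or $a_k<a_i<a_h<a_j$). For a word $\sigma$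 of distinct integers of length $k$, $F(V_\sigma,q)$ means $F(V_{\mathrm{st}(\sigma)},q)$ with $V$ taken in $\mathfrak{S}_k$, where $\mathrm{st}(\sigma)\in\mathfrak{S}_k$ replaces the $j$-th smallest letter by $j$. Notation: $[i]=1+q+\cdots+q^{i-1}$, $[n]!=[1]\cdots[n]$, $\begin{bmatrix}n\\ m\end{bmatrix}=\frac{[n]!}{[m]![n-m]!}$. -}

module Defs where

open import Data.Nat using (ℕ; zero; suc; _+_; _*_; _∸_; _<_; _<?_)
open import Data.Nat.Properties using (_≟_)
open import Data.List using (List; []; _∷_; _++_; map; length; filter; concatMap; upTo;
  replicate; foldr; sum; deduplicate; lookup; take; drop)
open import Data.List.Properties using (≡-dec)
open import Data.List.Relation.Binary.Permutation.Propositional using (_↭_)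
open import Data.Fin using (Fin) renaming (_<_ to _<ᶠ_)
open import Data.Product using (Σ; _×_)
open import Relation.Nullary using (¬_)
open import Relation.Binary.PropositionalEquality using (_≡_)

Word : Set
Word = List ℕ

IsPerm : ℕ → Word → Set
IsPerm n a = a ↭ map suc (upTo n)

-- first and last letters (default 0 for the empty word; only used when n ≥ 2)
first : Word → ℕ
first []      = 0
first (x ∷ _) = x

final : Word → ℕ
final []           = 0
final (x ∷ [])     = x
final (_ ∷ y ∷ xs) = final (y ∷ xs)

inv : Word → ℕ
inv []       = 0
inv (x ∷ xs) = length (filter (λ y → y <? x) xs) + inv xs

adjSwaps : Word → List Word
adjSwaps []           = []
adjSwaps (x ∷ [])     = []
adjSwaps (x ∷ y ∷ r)  = (y ∷ x ∷ r) ∷ map (x ∷_) (adjSwaps (y ∷ r))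

-- upper covers in weak order: σ = π sᵢ with ℓ(σ) > ℓ(π)
upCovers : Word → List Word
upCovers π = filter (λ σ → inv π <? inv σ) (adjSwaps π)

dedupW : List Word → List Word
dedupW = deduplicate (≡-dec _≟_)

reach : ℕ → List Word → List Word
reach zero    L = dedupW L
reach (suc k) L = reach k (dedupW (L ++ concatMap upCovers L))

-- V_π = [π, w₀]: every saturated chain from π has length ≤ ℓ(w₀) ≤ n·n,
-- so n·n cover steps reach the whole upper interval of the generated order.
V : Word → List Word
V π = reach (length π * length π) (π ∷ [])

-- Polynomials in q with ℕ coefficients, as coefficient lists (constant term first).
Poly : Set
Poly = List ℕ

_+P_ : Poly → Poly → Poly
[]      +P q       = q
(a ∷ p) +P []      = a ∷ p
(a ∷ p) +P (b ∷ q) = (a + b) ∷ (p +P q)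

_*P_ : Poly → Poly → Poly
[]      *P q = []
(a ∷ p) *P q = map (a *_) q +P (0 ∷ (p *P q))

coeff : Poly → ℕ → ℕ
coeff []      k       = 0
coeff (a ∷ p) zero    = a
coeff (a ∷ p) (suc k) = coeff p k

-- equality of polynomials (coefficientwise, so trailing zeros are irrelevant)
_≈P_ : Poly → Poly → Set
p ≈P q = ∀ k → coeff p k ≡ coeff q k

qpow : ℕ → Poly
qpow k = replicate k 0 ++ (1 ∷ [])

qint : ℕ → Poly
qint i = replicate i 1

qfact : ℕ → Poly
qfact zero    = 1 ∷ []
qfact (suc n) = qfact n *P qint (suc n)

st : Word → Word
st σ = map (λ x → suc (length (filter (λ y → y <? x) σ))) σ

Fperm : Word → Poly
Fperm π = foldr (λ v acc → qpow (inv v ∸ inv π) +P acc) [] (V π)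

F : Word → Poly
F σ = Fperm (st σ)

Contains3142 : Word → Set
Contains3142 a = Σ (Fin (length a)) λ i → Σ (Fin (length a)) λ j →
  Σ (Fin (length a)) λ k → Σ (Fin (length a)) λ h →
  i <ᶠ j × j <ᶠ k × k <ᶠ h ×
  lookup a j < lookup a h × lookup a h < lookup a i × lookup a i < lookup a k

Contains2413 : Word → Set
Contains2413 a = Σ (Fin (length a)) λ i → Σ (Fin (length a)) λ j →
  Σ (Fin (length a)) λ k → Σ (Fin (length a)) λ h →
  i <ᶠ j × j <ᶠ k × k <ᶠ h ×
  lookup a k < lookup a i × lookup a i < lookup a h × lookup a h < lookup a j

Separable : Word → Set
Separable a = ¬ Contains3142 a × ¬ Contains2413 a

module Submission where

-- For a word w with distinct letters, V w is described by inversion sets: σ ∈ V w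
-- iff σ rearranges w and keeps every inversion of w (w ≼ σ).  This computes the
-- interval above a concatenation A ++ B explicitly.  If all of A lies above all
-- of B (skew sum), V (A ++ B) = { a ++ b } and inversion numbers add, so
-- F(V_{A++B}) = F(V_A) F(V_B).  If all of A lies below all of B (direct sum),
-- V (A ++ B) consists of the shuffles of a ∈ V A and b ∈ V B, each adding its
-- crossings, so F(V_{A++B}) = [|A|+|B| choose |A|]_q F(V_A) F(V_B).  Since F is
-- invariant under increasing relabelling, st(σ) may be replaced by σ.  Finally a
-- separable word whose first letter is below (above) its last one admits such a
-- direct (skew) cut, for otherwise it contains 2413 (3142).

open import Defs

open import Level using (0ℓ)
open import Function using (_∘_; id)
open import Function.Bundles using (mk⇔)
open import Data.Empty using (⊥; ⊥-elim)
open import Data.Bool using (Bool; true; false; not)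
open import Data.Product using (Σ; _×_; _,_; proj₁; proj₂)
import Data.Product as Product
open import Data.Sum using (_⊎_; inj₁; inj₂; [_,_])
import Data.Sum as Sum
open import Relation.Nullary using (¬_; Dec; yes; no; ¬?; does; _×-dec_)
open import Relation.Unary using (Pred; Decidable)
open import Relation.Binary.Bundles using (Setoid)
open import Relation.Binary.Definitions using (tri<; tri≈; tri>)
open import Relation.Binary.PropositionalEquality hiding ([_])
import Relation.Binary.Reasoning.Setoid as SetoidReasoning

open import Data.Nat using (ℕ; zero; suc; _+_; _*_; _∸_; _≤_; _<_; _>_; _<?_; _≤?_; z≤n; s≤s)
open import Data.Nat.Properties
open import Data.Nat.Tactic.RingSolver using (solve-∀)
open import Data.Fin using (Fin; toℕ; fromℕ<)
import Data.Fin as Fin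
open import Data.Fin.Properties using (toℕ-fromℕ<)

open import Algebra.Bundles using (CommutativeSemiring)
open import Algebra.Structures.Biased using (isCommutativeSemiringʳ)
import Algebra.Solver.Ring.NaturalCoefficients.Default

open import Data.List
  using (List; []; _∷_; map; _++_; length; filter; foldr; take; drop; cartesianProduct; concatMap; lookup; upTo)
open import Data.List.Properties
  using (≡-dec; ∷-injective; ∷-injectiveʳ; ++-identityʳ; take++drop≡id; length-take; length-drop; length-map;
         length-upTo; length-filter; filter-accept; filter-reject; filter-all; filter-none; filter-++; length-++)
open import Data.List.Extrema.Nat using (max; xs≤max)
open import Data.List.Membership.Propositional using (_∈_; _∉_)
open import Data.List.Membership.Propositional.Properties
  using (∈-map⁺; ∈-map⁻; ∈-filter⁺; ∈-filter⁻; ∈-++⁺ˡ; ∈-++⁺ʳ; ∈-++⁻; ∈-deduplicate⁺; ∈-deduplicate⁻;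
         ∈-concatMap⁺; ∈-concat⁻′; ∈-cartesianProduct⁺; ∈-cartesianProduct⁻)
open import Data.List.Membership.Propositional.Properties.WithK using (unique∧set⇒bag)
open import Data.List.Membership.DecPropositional _≟_ using (_∈?_)
open import Data.List.Relation.Unary.Any as Any using (here; there)
open import Data.List.Relation.Unary.All as All using (All; []; _∷_)
open import Data.List.Relation.Unary.All.Properties using (All¬⇒¬Any)
import Data.List.Relation.Unary.All.Properties as AllP
open import Data.List.Relation.Unary.AllPairs using ([]; _∷_)
open import Data.List.Relation.Unary.Unique.Propositional using (Unique)
import Data.List.Relation.Unary.Unique.Propositional.Properties as UP
open import Data.List.Relation.Unary.Unique.DecPropositional.Properties using (deduplicate-!)
open import Data.List.Relation.Binary.BagAndSetEquality using (∼bag⇒↭)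
open import Data.List.Relation.Binary.Permutation.Propositional
  using (_↭_; ↭-refl; ↭-sym; ↭-trans; prep; swap; ↭⇒↭ₛ)
import Data.List.Relation.Binary.Permutation.Propositional as Perm
open import Data.List.Relation.Binary.Permutation.Propositional.Properties
  using (filter-↭; ↭-length; ∈-resp-↭; ++⁺ˡ; ++⁺; shift; ↭-map-inv; map⁺; drop-∷; ↭-empty-inv; ¬x∷xs↭[])
import Data.List.Relation.Binary.Permutation.Setoid.Properties as PermSetoid

-- Polynomials are equal when all their coefficients agree.  Wrapping the
-- pointwise equality _≈P_ in a record keeps both polynomials inferable.
infix 4 _≈_
record _≈_ (p q : Poly) : Set where
  constructor ≈-intro
  field coeff-≡ : ∀ k → coeff p k ≡ coeff q k
open _≈_ public

≈-refl : ∀ {p} → p ≈ p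
≈-refl = ≈-intro λ _ → refl

≈-sym : ∀ {p q} → p ≈ q → q ≈ p
≈-sym (≈-intro e) = ≈-intro λ k → sym (e k)

≈-trans : ∀ {p q r} → p ≈ q → q ≈ r → p ≈ r
≈-trans (≈-intro e) (≈-intro f) = ≈-intro λ k → trans (e k) (f k)

≈-setoid : Setoid 0ℓ 0ℓ
≈-setoid = record
  { Carrier = Poly ; _≈_ = _≈_
  ; isEquivalence = record { refl = ≈-refl ; sym = ≈-sym ; trans = ≈-trans } }

module ≈-Reasoning = SetoidReasoning ≈-setoid

≡⇒≈ : ∀ {p q} → p ≡ q → p ≈ q
≡⇒≈ refl = ≈-refl

∷-cong : ∀ {a b p q} → a ≡ b → p ≈ q → (a ∷ p) ≈ (b ∷ q)
∷-cong a≡b (≈-intro e) = ≈-intro λ { zero → a≡b ; (suc k) → e k }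

scale : ℕ → Poly → Poly
scale a = map (a *_)

coeff-+P : ∀ p q k → coeff (p +P q) k ≡ coeff p k + coeff q k
coeff-+P []      q       k       = refl
coeff-+P (a ∷ p) []      k       = sym (+-identityʳ _)
coeff-+P (a ∷ p) (b ∷ q) zero    = refl
coeff-+P (a ∷ p) (b ∷ q) (suc k) = coeff-+P p q k

coeff-scale : ∀ a q k → coeff (scale a q) k ≡ a * coeff q k
coeff-scale a []      k       = sym (*-zeroʳ a)
coeff-scale a (b ∷ q) zero    = refl
coeff-scale a (b ∷ q) (suc k) = coeff-scale a q k

+P-cong : ∀ {p p' q q'} → p ≈ p' → q ≈ q' → (p +P q) ≈ (p' +P q')
+P-cong {p} {p'} {q} {q'} (≈-intro e) (≈-intro f) = ≈-intro λ k → begin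
  coeff (p +P q) k        ≡⟨ coeff-+P p q k ⟩
  coeff p k + coeff q k   ≡⟨ cong₂ _+_ (e k) (f k) ⟩
  coeff p' k + coeff q' k ≡⟨ coeff-+P p' q' k ⟨
  coeff (p' +P q') k      ∎
  where open ≡-Reasoning

+P-comm : ∀ p q → (p +P q) ≈ (q +P p)
+P-comm p q = ≈-intro λ k → begin
  coeff (p +P q) k      ≡⟨ coeff-+P p q k ⟩
  coeff p k + coeff q k ≡⟨ +-comm (coeff p k) (coeff q k) ⟩
  coeff q k + coeff p k ≡⟨ coeff-+P q p k ⟨
  coeff (q +P p) k      ∎
  where open ≡-Reasoning

+P-assoc : ∀ p q r → ((p +P q) +P r) ≈ (p +P (q +P r))
+P-assoc p q r = ≈-intro λ k → begin
  coeff ((p +P q) +P r) k                ≡⟨ coeff-+P (p +P q) r k ⟩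
  coeff (p +P q) k + coeff r k           ≡⟨ cong (_+ coeff r k) (coeff-+P p q k) ⟩
  coeff p k + coeff q k + coeff r k      ≡⟨ +-assoc (coeff p k) _ _ ⟩
  coeff p k + (coeff q k + coeff r k)    ≡⟨ cong (coeff p k +_) (coeff-+P q r k) ⟨
  coeff p k + coeff (q +P r) k           ≡⟨ coeff-+P p (q +P r) k ⟨
  coeff (p +P (q +P r)) k                ∎
  where open ≡-Reasoning

+P-identityʳ : ∀ p → (p +P []) ≈ p
+P-identityʳ p = ≈-intro λ k → trans (coeff-+P p [] k) (+-identityʳ _)

+P-interchange : ∀ x y z w → ((x +P y) +P (z +P w)) ≈ ((x +P z) +P (y +P w))
+P-interchange x y z w = ≈-intro λ k → begin
  coeff ((x +P y) +P (z +P w)) k                    ≡⟨ coeff-+P (x +P y) (z +P w) k ⟩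
  coeff (x +P y) k + coeff (z +P w) k               ≡⟨ cong₂ _+_ (coeff-+P x y k) (coeff-+P z w k) ⟩
  (coeff x k + coeff y k) + (coeff z k + coeff w k) ≡⟨ swap-middle (coeff x k) (coeff y k) (coeff z k) (coeff w k) ⟩
  (coeff x k + coeff z k) + (coeff y k + coeff w k) ≡⟨ cong₂ _+_ (coeff-+P x z k) (coeff-+P y w k) ⟨
  coeff (x +P z) k + coeff (y +P w) k               ≡⟨ coeff-+P (x +P z) (y +P w) k ⟨
  coeff ((x +P z) +P (y +P w)) k                    ∎
  where
  open ≡-Reasoning
  swap-middle : ∀ a b c d → (a + b) + (c + d) ≡ (a + c) + (b + d)
  swap-middle = solve-∀

scale-cong : ∀ a {q q'} → q ≈ q' → scale a q ≈ scale a q'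
scale-cong a {q} {q'} (≈-intro e) = ≈-intro λ k → begin
  coeff (scale a q) k  ≡⟨ coeff-scale a q k ⟩
  a * coeff q k        ≡⟨ cong (a *_) (e k) ⟩
  a * coeff q' k       ≡⟨ coeff-scale a q' k ⟨
  coeff (scale a q') k ∎
  where open ≡-Reasoning

scale-+P : ∀ a q q' → scale a (q +P q') ≈ (scale a q +P scale a q')
scale-+P a q q' = ≈-intro λ k → begin
  coeff (scale a (q +P q')) k                 ≡⟨ coeff-scale a (q +P q') k ⟩
  a * coeff (q +P q') k                       ≡⟨ cong (a *_) (coeff-+P q q' k) ⟩
  a * (coeff q k + coeff q' k)                ≡⟨ *-distribˡ-+ a (coeff q k) (coeff q' k) ⟩
  a * coeff q k + a * coeff q' k              ≡⟨ cong₂ _+_ (coeff-scale a q k) (coeff-scale a q' k) ⟨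
  coeff (scale a q) k + coeff (scale a q') k  ≡⟨ coeff-+P (scale a q) (scale a q') k ⟨
  coeff (scale a q +P scale a q') k           ∎
  where open ≡-Reasoning

scale-scale : ∀ a b q → scale (a * b) q ≈ scale a (scale b q)
scale-scale a b q = ≈-intro λ k → begin
  coeff (scale (a * b) q) k     ≡⟨ coeff-scale (a * b) q k ⟩
  a * b * coeff q k             ≡⟨ *-assoc a b (coeff q k) ⟩
  a * (b * coeff q k)           ≡⟨ cong (a *_) (coeff-scale b q k) ⟨
  a * coeff (scale b q) k       ≡⟨ coeff-scale a (scale b q) k ⟨
  coeff (scale a (scale b q)) k ∎
  where open ≡-Reasoning

scale-shift : ∀ a q → scale a (0 ∷ q) ≈ (0 ∷ scale a q)
scale-shift a q = ∷-cong (*-zeroʳ a) ≈-refl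

*P-congʳ : ∀ p {q q'} → q ≈ q' → (p *P q) ≈ (p *P q')
*P-congʳ []      e = ≈-refl
*P-congʳ (a ∷ p) e = +P-cong (scale-cong a e) (∷-cong refl (*P-congʳ p e))

*P-zeroʳ : ∀ p → (p *P []) ≈ []
*P-zeroʳ []      = ≈-refl
*P-zeroʳ (a ∷ p) = ≈-intro λ { zero → refl ; (suc k) → coeff-≡ (*P-zeroʳ p) k }

*P-constʳ : ∀ q a → (q *P (a ∷ [])) ≈ scale a q
*P-constʳ []      a = ≈-refl
*P-constʳ (b ∷ q) a = ∷-cong (trans (+-identityʳ _) (*-comm b a)) (*P-constʳ q a)

*P-shiftʳ : ∀ p q → (p *P (0 ∷ q)) ≈ (0 ∷ (p *P q))
*P-shiftʳ []      q = ≈-intro λ { zero → refl ; (suc _) → refl }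
*P-shiftʳ (b ∷ p) q = +P-cong (scale-shift b q) (∷-cong refl (*P-shiftʳ p q))

*P-shiftˡ : ∀ p q → ((0 ∷ p) *P q) ≈ (0 ∷ (p *P q))
*P-shiftˡ p q = ≈-intro λ k → begin
  coeff (scale 0 q +P (0 ∷ (p *P q))) k           ≡⟨ coeff-+P (scale 0 q) (0 ∷ (p *P q)) k ⟩
  coeff (scale 0 q) k + coeff (0 ∷ (p *P q)) k    ≡⟨ cong (_+ coeff (0 ∷ (p *P q)) k) (coeff-scale 0 q k) ⟩
  coeff (0 ∷ (p *P q)) k                          ∎
  where open ≡-Reasoning

*P-distribˡ : ∀ p q q' → (p *P (q +P q')) ≈ ((p *P q) +P (p *P q'))
*P-distribˡ []      q q' = ≈-refl
*P-distribˡ (a ∷ p) q q' = ≈-trans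
  (+P-cong (scale-+P a q q') (∷-cong refl (*P-distribˡ p q q')))
  (+P-interchange (scale a q) (scale a q') (0 ∷ (p *P q)) (0 ∷ (p *P q')))

-- Commutativity: write a ∷ p as the constant a plus q·p and use distributivity.
*P-comm : ∀ p q → (p *P q) ≈ (q *P p)
*P-comm []      q = ≈-sym (*P-zeroʳ q)
*P-comm (a ∷ p) q = begin
  scale a q +P (0 ∷ (p *P q))         ≈⟨ +P-cong (*P-constʳ q a) (∷-cong refl (*P-comm q p)) ⟨
  (q *P (a ∷ [])) +P (0 ∷ (q *P p))   ≈⟨ +P-cong ≈-refl (*P-shiftʳ q p) ⟨
  (q *P (a ∷ [])) +P (q *P (0 ∷ p))   ≈⟨ *P-distribˡ q (a ∷ []) (0 ∷ p) ⟨
  q *P ((a + 0) ∷ p)                  ≈⟨ *P-congʳ q (∷-cong (+-identityʳ a) ≈-refl) ⟩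
  q *P (a ∷ p)                        ∎
  where open ≈-Reasoning

-- The remaining semiring laws follow from commutativity.
*P-congˡ : ∀ {p p'} q → p ≈ p' → (p *P q) ≈ (p' *P q)
*P-congˡ {p} {p'} q e = ≈-trans (*P-comm p q) (≈-trans (*P-congʳ q e) (*P-comm q p'))

*P-cong : ∀ {p p' q q'} → p ≈ p' → q ≈ q' → (p *P q) ≈ (p' *P q')
*P-cong {p' = p'} {q} e f = ≈-trans (*P-congˡ q e) (*P-congʳ p' f)

*P-distribʳ : ∀ p p' q → ((p +P p') *P q) ≈ ((p *P q) +P (p' *P q))
*P-distribʳ p p' q = begin
  (p +P p') *P q           ≈⟨ *P-comm (p +P p') q ⟩
  q *P (p +P p')           ≈⟨ *P-distribˡ q p p' ⟩
  (q *P p) +P (q *P p')    ≈⟨ +P-cong (*P-comm q p) (*P-comm q p') ⟩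
  (p *P q) +P (p' *P q)    ∎
  where open ≈-Reasoning

scale-*P : ∀ a q r → (scale a q *P r) ≈ scale a (q *P r)
scale-*P a []      r = ≈-refl
scale-*P a (b ∷ q) r = begin
  scale (a * b) r +P (0 ∷ (scale a q *P r))      ≈⟨ +P-cong (scale-scale a b r) (∷-cong refl (scale-*P a q r)) ⟩
  scale a (scale b r) +P (0 ∷ scale a (q *P r))  ≈⟨ +P-cong ≈-refl (scale-shift a (q *P r)) ⟨
  scale a (scale b r) +P scale a (0 ∷ (q *P r))  ≈⟨ scale-+P a (scale b r) (0 ∷ (q *P r)) ⟨
  scale a (scale b r +P (0 ∷ (q *P r)))          ∎
  where open ≈-Reasoning

*P-assoc : ∀ p q r → ((p *P q) *P r) ≈ (p *P (q *P r))
*P-assoc []      q r = ≈-refl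
*P-assoc (a ∷ p) q r = begin
  (scale a q +P (0 ∷ (p *P q))) *P r              ≈⟨ *P-distribʳ (scale a q) (0 ∷ (p *P q)) r ⟩
  (scale a q *P r) +P ((0 ∷ (p *P q)) *P r)       ≈⟨ +P-cong (scale-*P a q r) (*P-shiftˡ (p *P q) r) ⟩
  scale a (q *P r) +P (0 ∷ ((p *P q) *P r))       ≈⟨ +P-cong ≈-refl (∷-cong refl (*P-assoc p q r)) ⟩
  scale a (q *P r) +P (0 ∷ (p *P (q *P r)))       ∎
  where open ≈-Reasoning

*P-identityʳ : ∀ q → (q *P (1 ∷ [])) ≈ q
*P-identityʳ q = ≈-trans (*P-constʳ q 1) (≈-intro λ k → trans (coeff-scale 1 q k) (*-identityˡ _))

*P-identityˡ : ∀ q → ((1 ∷ []) *P q) ≈ q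
*P-identityˡ q = ≈-trans (*P-comm (1 ∷ []) q) (*P-identityʳ q)

polySemiring : CommutativeSemiring 0ℓ 0ℓ
polySemiring = record
  { Carrier = Poly ; _≈_ = _≈_ ; _+_ = _+P_ ; _*_ = _*P_ ; 0# = [] ; 1# = 1 ∷ []
  ; isCommutativeSemiring = isCommutativeSemiringʳ record
    { +-isCommutativeMonoid = record
      { isMonoid = record
        { isSemigroup = record
          { isMagma = record { isEquivalence = ≈-isEquivalence ; ∙-cong = +P-cong }
          ; assoc = +P-assoc }
        ; identity = (λ _ → ≈-refl) , +P-identityʳ }
      ; comm = +P-comm }
    ; *-isCommutativeMonoid = record
      { isMonoid = record
        { isSemigroup = record
          { isMagma = record { isEquivalence = ≈-isEquivalence ; ∙-cong = *P-cong }
          ; assoc = *P-assoc }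
        ; identity = *P-identityˡ , *P-identityʳ }
      ; comm = *P-comm }
    ; distribˡ = *P-distribˡ
    ; zeroʳ = *P-zeroʳ } }
  where ≈-isEquivalence = Setoid.isEquivalence ≈-setoid

module PolySolver = Algebra.Solver.Ring.NaturalCoefficients.Default polySemiring

qpow-+ : ∀ i j → qpow (i + j) ≈ (qpow i *P qpow j)
qpow-+ zero    j = ≈-sym (*P-identityˡ (qpow j))
qpow-+ (suc i) j = ≈-trans (∷-cong refl (qpow-+ i j)) (≈-sym (*P-shiftˡ (qpow i) (qpow j)))

qint-+ : ∀ a b → qint (a + b) ≈ (qint a +P (qpow a *P qint b))
qint-+ zero    b = ≈-sym (*P-identityˡ (qint b))
qint-+ (suc a) b = ≈-trans (∷-cong refl (qint-+ a b)) (+P-cong (≈-refl {qint (suc a)}) (≈-sym (*P-shiftˡ (qpow a) (qint b))))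

sumP : {A : Set} → (A → Poly) → List A → Poly
sumP f = foldr (λ x acc → f x +P acc) []

module _ {A : Set} where

  sumP-cong : ∀ {f g : A → Poly} L → (∀ {x} → x ∈ L → f x ≈ g x) → sumP f L ≈ sumP g L
  sumP-cong []      f≈g = ≈-refl
  sumP-cong (x ∷ L) f≈g = +P-cong (f≈g (here refl)) (sumP-cong L (f≈g ∘ there))

  sumP-++ : ∀ (f : A → Poly) L M → sumP f (L ++ M) ≈ (sumP f L +P sumP f M)
  sumP-++ f []      M = ≈-refl
  sumP-++ f (x ∷ L) M = ≈-trans (+P-cong ≈-refl (sumP-++ f L M)) (≈-sym (+P-assoc (f x) _ _))

  sumP-scale : ∀ c (f : A → Poly) L → sumP (λ x → c *P f x) L ≈ (c *P sumP f L)
  sumP-scale c f []      = ≈-sym (*P-zeroʳ c)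
  sumP-scale c f (x ∷ L) = ≈-trans (+P-cong ≈-refl (sumP-scale c f L)) (≈-sym (*P-distribˡ c (f x) (sumP f L)))

  sumP-↭ : ∀ (f : A → Poly) {L M} → L ↭ M → sumP f L ≈ sumP f M
  sumP-↭ f Perm.refl          = ≈-refl
  sumP-↭ f (Perm.prep x p)    = +P-cong ≈-refl (sumP-↭ f p)
  sumP-↭ f (Perm.swap x y p)  = ≈-trans (≈-sym (+P-assoc (f x) (f y) _))
    (≈-trans (+P-cong (+P-comm (f x) (f y)) (sumP-↭ f p)) (+P-assoc (f y) (f x) _))
  sumP-↭ f (Perm.trans p q)   = ≈-trans (sumP-↭ f p) (sumP-↭ f q)

sumP-map : ∀ {A B : Set} (f : B → Poly) (h : A → B) L → sumP f (map h L) ≡ sumP (f ∘ h) L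
sumP-map f h []      = refl
sumP-map f h (x ∷ L) = cong (f (h x) +P_) (sumP-map f h L)

sumP-cartesian : ∀ {A B : Set} (f : A → Poly) (g : B → Poly) L M →
  sumP (λ xy → f (proj₁ xy) *P g (proj₂ xy)) (cartesianProduct L M) ≈ (sumP f L *P sumP g M)
sumP-cartesian f g []      M = ≈-refl
sumP-cartesian f g (x ∷ L) M = begin
  sumP fg (map (x ,_) M ++ cartesianProduct L M)              ≈⟨ sumP-++ fg (map (x ,_) M) _ ⟩
  sumP fg (map (x ,_) M) +P sumP fg (cartesianProduct L M)    ≈⟨ +P-cong (≡⇒≈ (sumP-map fg (x ,_) M)) (sumP-cartesian f g L M) ⟩
  sumP (λ y → f x *P g y) M +P (sumP f L *P sumP g M)         ≈⟨ +P-cong (sumP-scale (f x) g M) ≈-refl ⟩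
  (f x *P sumP g M) +P (sumP f L *P sumP g M)                 ≈⟨ *P-distribʳ (f x) (sumP f L) (sumP g M) ⟨
  (f x +P sumP f L) *P sumP g M                               ∎
  where
  open ≈-Reasoning
  fg = λ xy → f (proj₁ xy) *P g (proj₂ xy)

-- below x u counts the letters of u smaller than x, so that by definition
-- inv (x ∷ u) = below x u + inv u.
below : ℕ → Word → ℕ
below x u = length (filter (_<? x) u)

below-↭ : ∀ x {u u'} → u ↭ u' → below x u ≡ below x u'
below-↭ x p = ↭-length (filter-↭ (_<? x) p)

below-∷-< : ∀ {x y} r → y < x → below x (y ∷ r) ≡ suc (below x r)
below-∷-< {x} r y<x = cong length (filter-accept (_<? x) y<x)

below-∷-≮ : ∀ {x y} r → ¬ y < x → below x (y ∷ r) ≡ below x r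
below-∷-≮ {x} r y≮x = cong length (filter-reject (_<? x) y≮x)

below-++ : ∀ x u v → below x (u ++ v) ≡ below x u + below x v
below-++ x u v = trans (cong length (filter-++ (_<? x) u v)) (length-++ (filter (_<? x) u))

below-all : ∀ x u → (∀ {y} → y ∈ u → y < x) → below x u ≡ length u
below-all x u all< = cong length (filter-all (_<? x) (All.tabulate all<))

below-none : ∀ x u → (∀ {y} → y ∈ u → ¬ y < x) → below x u ≡ 0
below-none x u none< = cong length (filter-none (_<? x) (All.tabulate none<))

inv-bound : ∀ u → inv u ≤ length u * length u
inv-bound []      = z≤n
inv-bound (x ∷ u) = begin
  below x u + inv u                ≤⟨ +-mono-≤ (length-filter (_<? x) u) (inv-bound u) ⟩
  length u + length u * length u   ≤⟨ +-mono-≤ (n≤1+n _) (*-monoʳ-≤ (length u) (n≤1+n _)) ⟩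
  suc (length u) * suc (length u)  ∎
  where open ≤-Reasoning

cross : Word → Word → ℕ
cross []      v = 0
cross (x ∷ u) v = below x v + cross u v

inv-++ : ∀ u v → inv (u ++ v) ≡ cross u v + inv u + inv v
inv-++ []      v = refl
inv-++ (x ∷ u) v = begin
  below x (u ++ v) + inv (u ++ v)                       ≡⟨ cong₂ _+_ (below-++ x u v) (inv-++ u v) ⟩
  (below x u + below x v) + (cross u v + inv u + inv v) ≡⟨ regroup (below x u) (below x v) (cross u v) (inv u) (inv v) ⟩
  (below x v + cross u v) + (below x u + inv u) + inv v ∎
  where
  open ≡-Reasoning
  regroup : ∀ a b c d e → (a + b) + (c + d + e) ≡ (b + c) + (a + d) + e
  regroup = solve-∀

cross-↭ʳ : ∀ u {v v'} → v ↭ v' → cross u v ≡ cross u v'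
cross-↭ʳ []      p = refl
cross-↭ʳ (x ∷ u) p = cong₂ _+_ (below-↭ x p) (cross-↭ʳ u p)

cross-all : ∀ u v → (∀ {x y} → x ∈ u → y ∈ v → y < x) → cross u v ≡ length u * length v
cross-all []      v h = refl
cross-all (x ∷ u) v h = cong₂ _+_ (below-all x v (h (here refl))) (cross-all u v (h ∘ there))

cross-none : ∀ u v → (∀ {x y} → x ∈ u → y ∈ v → x < y) → cross u v ≡ 0
cross-none []      v h = refl
cross-none (x ∷ u) v h =
  cong₂ _+_ (below-none x v λ y∈v y<x → <-asym y<x (h (here refl) y∈v)) (cross-none u v (h ∘ there))

inv-swap-ascent : ∀ {c z} s → c < z → inv (z ∷ c ∷ s) ≡ suc (inv (c ∷ z ∷ s))
inv-swap-ascent {c} {z} s c<z = begin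
  below z (c ∷ s) + (below c s + inv s)     ≡⟨ cong (_+ (below c s + inv s)) (below-∷-< s c<z) ⟩
  suc (below z s + (below c s + inv s))     ≡⟨ cong suc (+-comm (below z s) (below c s + inv s)) ⟩
  suc ((below c s + inv s) + below z s)     ≡⟨ cong suc (+-assoc (below c s) (inv s) (below z s)) ⟩
  suc (below c s + (inv s + below z s))     ≡⟨ cong (λ t → suc (below c s + t)) (+-comm (inv s) (below z s)) ⟩
  suc (below c s + (below z s + inv s))     ≡⟨ cong (λ t → suc (t + (below z s + inv s))) (below-∷-≮ s (<-asym c<z)) ⟨
  suc (below c (z ∷ s) + (below z s + inv s)) ∎
  where open ≡-Reasoning

inv-swap-nonascent : ∀ {x y} r → ¬ x < y → inv (y ∷ x ∷ r) ≤ inv (x ∷ y ∷ r)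
inv-swap-nonascent {x} {y} r x≮y = begin
  below y (x ∷ r) + (below x r + inv r)  ≡⟨ cong (_+ (below x r + inv r)) (below-∷-≮ r x≮y) ⟩
  below y r + (below x r + inv r)        ≡⟨ exchange (below y r) (below x r) (inv r) ⟩
  below x r + (below y r + inv r)        ≤⟨ +-monoˡ-≤ (below y r + inv r) (below-∷ (y <? x)) ⟩
  below x (y ∷ r) + (below y r + inv r)  ∎
  where
  open ≤-Reasoning
  exchange : ∀ a b c → a + (b + c) ≡ b + (a + c)
  exchange = solve-∀
  below-∷ : Dec (y < x) → below x r ≤ below x (y ∷ r)
  below-∷ (yes y<x) = ≤-trans (n≤1+n _) (≤-reflexive (sym (below-∷-< r y<x)))
  below-∷ (no y≮x)  = ≤-reflexive (sym (below-∷-≮ r y≮x))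

unique-resp-↭ : {A : Set} {xs ys : List A} → xs ↭ ys → Unique xs → Unique ys
unique-resp-↭ {A} p = PermSetoid.Unique-resp-↭ (setoid A) (↭⇒↭ₛ p)

data Before : Word → ℕ → ℕ → Set where
  at-head : ∀ {a b r}   → b ∈ r → Before (a ∷ r) a b
  in-tail : ∀ {c a b r} → Before r a b → Before (c ∷ r) a b

Before-∈₁ : ∀ {u a b} → Before u a b → a ∈ u
Before-∈₁ (at-head _) = here refl
Before-∈₁ (in-tail p) = there (Before-∈₁ p)

Before-∈₂ : ∀ {u a b} → Before u a b → b ∈ u
Before-∈₂ (at-head b∈r) = there b∈r
Before-∈₂ (in-tail p)   = there (Before-∈₂ p)

Before-≢ : ∀ {u a b} → Unique u → Before u a b → a ≢ b
Before-≢ (a∉r ∷ _) (at-head b∈r) refl = All¬⇒¬Any a∉r b∈r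
Before-≢ (_ ∷ u)   (in-tail p)        = Before-≢ u p

-- The weak order through inversion sets: w ≼ σ when σ rearranges w and every
-- inversion of w (a larger letter before a smaller one) is an inversion of σ.
-- For words with distinct letters this is exactly the upper interval V w.
record _≼_ (w σ : Word) : Set where
  constructor ≼-intro
  field
    rearranges : σ ↭ w
    keeps      : ∀ {a b} → b < a → Before w a b → Before σ a b
open _≼_ public

≼-refl : ∀ {w} → w ≼ w
≼-refl = ≼-intro ↭-refl λ _ p → p

≼-trans : ∀ {u v w} → u ≼ v → v ≼ w → u ≼ w
≼-trans (≼-intro p k) (≼-intro p' k') = ≼-intro (↭-trans p' p) λ lt b → k' lt (k lt b)

≼-cons : ∀ {x u u'} → u ≼ u' → (x ∷ u) ≼ (x ∷ u')
≼-cons {x} (≼-intro p k) = ≼-intro (prep x p) λ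
  { lt (at-head m) → at-head (∈-resp-↭ (↭-sym p) m)
  ; lt (in-tail b) → in-tail (k lt b) }

adjSwaps-↭ : ∀ {σ τ} → σ ∈ adjSwaps τ → σ ↭ τ
adjSwaps-↭ {τ = x ∷ y ∷ r} (here refl) = swap y x ↭-refl
adjSwaps-↭ {τ = x ∷ y ∷ r} (there m) with ∈-map⁻ (x ∷_) m
... | σ' , m' , refl = prep x (adjSwaps-↭ m')

adjSwap-≼ : ∀ {σ τ} → σ ∈ adjSwaps τ → inv τ < inv σ → τ ≼ σ
adjSwap-≼ {τ = x ∷ y ∷ r} (here refl) inv< with x <? y
... | no x≮y = ⊥-elim (<⇒≱ inv< (inv-swap-nonascent r x≮y))
... | yes x<y = ≼-intro (swap y x ↭-refl) keeps-swap
  where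
  keeps-swap : ∀ {a b} → b < a → Before (x ∷ y ∷ r) a b → Before (y ∷ x ∷ r) a b
  keeps-swap b<a (at-head (here refl))  = ⊥-elim (<-asym b<a x<y)
  keeps-swap b<a (at-head (there m))    = in-tail (at-head m)
  keeps-swap b<a (in-tail (at-head m))  = at-head (there m)
  keeps-swap b<a (in-tail (in-tail p))  = in-tail (in-tail p)
adjSwap-≼ {τ = x ∷ y ∷ r} (there m) inv< with ∈-map⁻ (x ∷_) m
... | σ' , m' , refl = ≼-cons (adjSwap-≼ m' (+-cancelˡ-< (below x (y ∷ r)) _ _ inv<′))
  where
  inv<′ : below x (y ∷ r) + inv (y ∷ r) < below x (y ∷ r) + inv σ'
  inv<′ = subst (λ c → below x (y ∷ r) + inv (y ∷ r) < c + inv σ') (below-↭ x (adjSwaps-↭ m')) inv<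

upCovers-≼ : ∀ {σ τ} → σ ∈ upCovers τ → τ ≼ σ
upCovers-≼ {σ} {τ} m = let (m' , inv<) = ∈-filter⁻ (λ σ → inv τ <? inv σ) {xs = adjSwaps τ} m in adjSwap-≼ m' inv<

upCovers-inv : ∀ {σ τ} → σ ∈ upCovers τ → inv τ < inv σ
upCovers-inv {σ} {τ} m = proj₂ (∈-filter⁻ (λ σ → inv τ <? inv σ) {xs = adjSwaps τ} m)

split-before : ∀ x w {z} → z ∈ w → Σ Word λ p → Σ ℕ λ c → Σ Word λ s → x ∷ w ≡ p ++ c ∷ z ∷ s
split-before x (z ∷ s) (here refl) = [] , x , s , refl
split-before x (y ∷ w) (there m) with split-before y w m
... | p , c , s , e = x ∷ p , c , s , cong (x ∷_) e

Before-adjacent : ∀ p c z s → Before (p ++ c ∷ z ∷ s) c z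
Before-adjacent []      c z s = at-head (here refl)
Before-adjacent (x ∷ p) c z s = in-tail (Before-adjacent p c z s)

Before-swap : ∀ p c z s {a b} → Before (p ++ z ∷ c ∷ s) a b → (a ≡ z × b ≡ c) ⊎ Before (p ++ c ∷ z ∷ s) a b
Before-swap []      c z s (at-head (here refl))  = inj₁ (refl , refl)
Before-swap []      c z s (at-head (there m))    = inj₂ (in-tail (at-head m))
Before-swap []      c z s (in-tail (at-head m))  = inj₂ (at-head (there m))
Before-swap []      c z s (in-tail (in-tail b))  = inj₂ (in-tail (in-tail b))
Before-swap (x ∷ p) c z s (at-head m)            = inj₂ (at-head (∈-resp-↭ (++⁺ˡ p (swap z c ↭-refl)) m))
Before-swap (x ∷ p) c z s (in-tail b)            = Sum.map₂ in-tail (Before-swap p c z s b)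

inv-swap : ∀ p {c z} s → c < z → inv (p ++ c ∷ z ∷ s) < inv (p ++ z ∷ c ∷ s)
inv-swap p {c} {z} s c<z = begin-strict
  inv (p ++ c ∷ z ∷ s)                              ≡⟨ inv-++ p (c ∷ z ∷ s) ⟩
  cross p (c ∷ z ∷ s) + inv p + inv (c ∷ z ∷ s)
    <⟨ +-monoʳ-< (cross p (c ∷ z ∷ s) + inv p) (≤-reflexive (sym (inv-swap-ascent s c<z))) ⟩
  cross p (c ∷ z ∷ s) + inv p + inv (z ∷ c ∷ s)
    ≡⟨ cong (λ t → t + inv p + inv (z ∷ c ∷ s)) (cross-↭ʳ p (swap c z ↭-refl)) ⟩
  cross p (z ∷ c ∷ s) + inv p + inv (z ∷ c ∷ s)     ≡⟨ inv-++ p (z ∷ c ∷ s) ⟨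
  inv (p ++ z ∷ c ∷ s)                              ∎
  where open ≤-Reasoning

swap-∈-adjSwaps : ∀ p c z s → (p ++ z ∷ c ∷ s) ∈ adjSwaps (p ++ c ∷ z ∷ s)
swap-∈-adjSwaps []           c z s = here refl
swap-∈-adjSwaps (x ∷ [])     c z s = there (∈-map⁺ (x ∷_) (swap-∈-adjSwaps [] c z s))
swap-∈-adjSwaps (x ∷ y ∷ p)  c z s = there (∈-map⁺ (x ∷_) (swap-∈-adjSwaps (y ∷ p) c z s))

swap-∈-upCovers : ∀ p {c z} s → c < z → (p ++ z ∷ c ∷ s) ∈ upCovers (p ++ c ∷ z ∷ s)
swap-∈-upCovers p {c} {z} s c<z =
  ∈-filter⁺ (λ σ → inv (p ++ c ∷ z ∷ s) <? inv σ) (swap-∈-adjSwaps p c z s) (inv-swap p s c<z)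

-- If w = p ++ c ∷ z ∷ s ≼ z ∷ σ₁ (distinct letters), then c z is an ascent and
-- swapping it keeps w below z ∷ σ₁: z must move in front of c.
swap-toward-head : ∀ p c z s σ₁ → Unique (p ++ c ∷ z ∷ s) → (p ++ c ∷ z ∷ s) ≼ (z ∷ σ₁) →
  c < z × (p ++ z ∷ c ∷ s) ≼ (z ∷ σ₁)
swap-toward-head p c z s σ₁ uw w≼σ with unique-resp-↭ (↭-sym (rearranges w≼σ)) uw
... | z∉σ₁ ∷ _ = c<z , ≼-intro (↭-trans (rearranges w≼σ) (++⁺ˡ p (swap c z ↭-refl))) keeps′
  where
  c≢z : c ≢ z
  c≢z = Before-≢ uw (Before-adjacent p c z s)
  c<z : c < z
  c<z with <-cmp c z
  ... | tri< c<z _ _ = c<z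
  ... | tri≈ _ c≡z _ = ⊥-elim (c≢z c≡z)
  ... | tri> _ _ z<c with keeps w≼σ z<c (Before-adjacent p c z s)
  ...   | at-head _  = ⊥-elim (c≢z refl)
  ...   | in-tail cz = ⊥-elim (All¬⇒¬Any z∉σ₁ (Before-∈₂ cz))
  c∈σ₁ : c ∈ σ₁
  c∈σ₁ with ∈-resp-↭ (↭-sym (rearranges w≼σ)) (Before-∈₁ (Before-adjacent p c z s))
  ... | here c≡z = ⊥-elim (c≢z c≡z)
  ... | there m  = m
  keeps′ : ∀ {a b} → b < a → Before (p ++ z ∷ c ∷ s) a b → Before (z ∷ σ₁) a b
  keeps′ b<a ab with Before-swap p c z s ab
  ... | inj₁ (refl , refl) = at-head c∈σ₁
  ... | inj₂ ab′           = keeps w≼σ b<a ab′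

≼-uncons : ∀ {x w σ} → Unique (x ∷ w) → (x ∷ w) ≼ (x ∷ σ) → w ≼ σ
≼-uncons {w = w} {σ} (x∉w ∷ _) x∷w≼x∷σ = ≼-intro (drop-∷ (rearranges x∷w≼x∷σ)) keeps′
  where
  keeps′ : ∀ {a b} → b < a → Before w a b → Before σ a b
  keeps′ b<a ab with keeps x∷w≼x∷σ b<a (in-tail ab)
  ... | at-head _  = ⊥-elim (All¬⇒¬Any x∉w (Before-∈₁ ab))
  ... | in-tail ab′ = ab′

≼-ascent : ∀ w σ → Unique w → w ≼ σ → w ≢ σ →
  Σ Word λ p → Σ ℕ λ c → Σ ℕ λ z → Σ Word λ s → w ≡ p ++ c ∷ z ∷ s × c < z × (p ++ z ∷ c ∷ s) ≼ σ
≼-ascent []      σ uw w≼σ w≢σ = ⊥-elim (w≢σ (sym (↭-empty-inv (rearranges w≼σ))))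
≼-ascent (x ∷ w) [] uw w≼σ w≢σ = ⊥-elim (¬x∷xs↭[] (↭-sym (rearranges w≼σ)))
≼-ascent (x ∷ w) (z ∷ σ) uw@(_ ∷ uw₁) w≼σ w≢σ with x ≟ z
... | yes refl with ≼-ascent w σ uw₁ (≼-uncons uw w≼σ) (w≢σ ∘ cong (x ∷_))
...   | p , c , z' , s , e , c<z , swapped≼ = x ∷ p , c , z' , s , cong (x ∷_) e , c<z , ≼-cons swapped≼
≼-ascent (x ∷ w) (z ∷ σ) uw w≼σ w≢σ | no x≢z with ∈-resp-↭ (rearranges w≼σ) (here {x = z} {xs = σ} refl)
... | here z≡x = ⊥-elim (x≢z (sym z≡x))
... | there z∈w with split-before x w z∈w
...   | p , c , s , e with swap-toward-head p c z s σ (subst Unique e uw) (subst (_≼ (z ∷ σ)) e w≼σ)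
...     | c<z , swapped≼ = p , c , z , s , e , c<z , swapped≼

data Path : ℕ → Word → Word → Set where
  stop : ∀ {k w} → Path k w w
  step : ∀ {k w w' σ} → w' ∈ upCovers w → Path k w' σ → Path (suc k) w σ

reach-complete : ∀ k L {τ σ} → τ ∈ L → Path k τ σ → σ ∈ reach k L
reach-complete zero    L τ∈L stop = ∈-deduplicate⁺ (≡-dec _≟_) τ∈L
reach-complete (suc k) L τ∈L stop = reach-complete k _ (∈-deduplicate⁺ (≡-dec _≟_) (∈-++⁺ˡ τ∈L)) stop
reach-complete (suc k) L τ∈L (step cover path) =
  reach-complete k _ (∈-deduplicate⁺ (≡-dec _≟_) (∈-++⁺ʳ L (∈-concatMap⁺ upCovers (Any.map (λ { refl → cover }) τ∈L)))) path

reach-sound : ∀ (Q : Word → Set) → (∀ {τ τ'} → Q τ → τ' ∈ upCovers τ → Q τ') →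
  ∀ k L → (∀ {τ} → τ ∈ L → Q τ) → ∀ {σ} → σ ∈ reach k L → Q σ
reach-sound Q closed zero    L QL σ∈ = QL (∈-deduplicate⁻ (≡-dec _≟_) L σ∈)
reach-sound Q closed (suc k) L QL σ∈ = reach-sound Q closed k _ QL′ σ∈
  where
  QL′ : ∀ {τ} → τ ∈ dedupW (L ++ concatMap upCovers L) → Q τ
  QL′ τ∈ with ∈-++⁻ L (∈-deduplicate⁻ (≡-dec _≟_) (L ++ concatMap upCovers L) τ∈)
  ... | inj₁ τ∈L = QL τ∈L
  ... | inj₂ τ∈covers with ∈-concat⁻′ (map upCovers L) τ∈covers
  ...   | covers , τ∈cover , cover∈ with ∈-map⁻ upCovers cover∈
  ...     | τ₀ , τ₀∈L , refl = closed (QL τ₀∈L) τ∈cover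

reach-unique : ∀ k L → Unique (reach k L)
reach-unique zero    L = deduplicate-! (≡-dec _≟_) L
reach-unique (suc k) L = reach-unique k _

-- Every σ ≽ u is reached from u within n·n ∸ inv u covers, since each cover
-- raises the inversion number, which never exceeds n·n.
≼⇒Path : ∀ n fuel u σ → Unique u → u ≼ σ → length u ≡ n → n * n ∸ inv u ≤ fuel → Path fuel u σ
≼⇒Path n fuel u σ uu u≼σ len bound with ≡-dec _≟_ u σ
... | yes refl = stop
... | no u≢σ with ≼-ascent u σ uu u≼σ u≢σ
...   | p , c , z , s , refl , c<z , swapped≼ = climb fuel bound
  where
  swapped = p ++ z ∷ c ∷ s
  rearranged : swapped ↭ p ++ c ∷ z ∷ s
  rearranged = ++⁺ˡ p (swap z c ↭-refl)
  len′ : length swapped ≡ n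
  len′ = trans (↭-length rearranged) len
  inv<inv′ : inv (p ++ c ∷ z ∷ s) < inv swapped
  inv<inv′ = inv-swap p s c<z
  inv′≤ : inv swapped ≤ n * n
  inv′≤ = subst (λ m → inv swapped ≤ m * m) len′ (inv-bound swapped)
  climb : ∀ fuel → n * n ∸ inv (p ++ c ∷ z ∷ s) ≤ fuel → Path fuel (p ++ c ∷ z ∷ s) σ
  climb zero       bound = ⊥-elim (<⇒≱ (≤-trans inv<inv′ inv′≤) (m∸n≡0⇒m≤n (n≤0⇒n≡0 bound)))
  climb (suc fuel) bound = step (swap-∈-upCovers p s c<z)
    (≼⇒Path n fuel swapped σ (unique-resp-↭ (↭-sym rearranged) uu) swapped≼ len′
      (≤-pred (≤-trans (∸-monoʳ-< inv<inv′ inv′≤) bound)))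

V-sound : ∀ w {σ} → σ ∈ V w → w ≼ σ × inv w ≤ inv σ
V-sound w = reach-sound (λ τ → w ≼ τ × inv w ≤ inv τ)
  (λ { {τ} {τ'} (w≼τ , inv≤) cover →
      ≼-trans w≼τ (upCovers-≼ {τ'} {τ} cover) , ≤-trans inv≤ (<⇒≤ (upCovers-inv {τ'} {τ} cover)) })
  (length w * length w) (w ∷ []) (λ { (here refl) → ≼-refl , ≤-refl })

V-complete : ∀ w {σ} → Unique w → w ≼ σ → σ ∈ V w
V-complete w {σ} uw w≼σ = reach-complete (length w * length w) (w ∷ []) (here refl)
  (≼⇒Path (length w) (length w * length w) w σ uw w≼σ refl (m∸n≤m (length w * length w) (inv w)))

V-unique : ∀ w → Unique (V w)
V-unique w = reach-unique (length w * length w) (w ∷ [])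

-- The summand of F(V_w): a word v ∈ V w contributes q^(ℓ(v) - ℓ(w)), so that
-- Fperm w is, by definition, sumP (weight w) (V w).
weight : Word → Word → Poly
weight w v = qpow (inv v ∸ inv w)

unique-map : ∀ {A B : Set} (h : A → B) L → Unique L →
  (∀ {x y} → x ∈ L → y ∈ L → h x ≡ h y → x ≡ y) → Unique (map h L)
unique-map h []      []           inj = []
unique-map h (x ∷ L) (x∉L ∷ uL)   inj =
  All.tabulate fresh ∷ unique-map h L uL λ x∈ y∈ → inj (there x∈) (there y∈)
  where
  fresh : ∀ {y} → y ∈ map h L → h x ≢ y
  fresh y∈ hx≡y with ∈-map⁻ h y∈
  ... | x′ , x′∈L , refl = All¬⇒¬Any x∉L (subst (_∈ L) (sym (inj (here refl) (there x′∈L) hx≡y)) x′∈L)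

Fperm-reindex : ∀ {A : Set} w (h : A → Word) L → Unique L →
  (∀ {x y} → x ∈ L → y ∈ L → h x ≡ h y → x ≡ y) →
  (∀ {σ} → σ ∈ V w → σ ∈ map h L) → (∀ {x} → x ∈ L → h x ∈ V w) →
  Fperm w ≈ sumP (weight w ∘ h) L
Fperm-reindex w h L uL inj onto into = begin
  sumP (weight w) (V w)         ≈⟨ sumP-↭ (weight w) V↭image ⟩
  sumP (weight w) (map h L)     ≡⟨ sumP-map (weight w) h L ⟩
  sumP (weight w ∘ h) L         ∎
  where
  open ≈-Reasoning
  V↭image : V w ↭ map h L
  V↭image = ∼bag⇒↭ (unique∧set⇒bag (V-unique w) (unique-map h L uL inj) (mk⇔ onto λ σ∈ → image-into σ∈))
    where
    image-into : ∀ {σ} → σ ∈ map h L → σ ∈ V w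
    image-into σ∈ with ∈-map⁻ h σ∈
    ... | x , x∈L , refl = into x∈L

Before-++ˡ : ∀ {u x y} v → Before u x y → Before (u ++ v) x y
Before-++ˡ v (at-head m) = at-head (∈-++⁺ˡ m)
Before-++ˡ v (in-tail p) = in-tail (Before-++ˡ v p)

Before-++ʳ : ∀ u {v x y} → Before v x y → Before (u ++ v) x y
Before-++ʳ []      p = p
Before-++ʳ (z ∷ u) p = in-tail (Before-++ʳ u p)

Before-across : ∀ {u v x y} → x ∈ u → y ∈ v → Before (u ++ v) x y
Before-across {u = z ∷ u} (here refl) y∈v = at-head (∈-++⁺ʳ u y∈v)
Before-across (there x∈u) y∈v = in-tail (Before-across x∈u y∈v)

Before-++⁻ : ∀ u {v x y} → Before (u ++ v) x y → Before u x y ⊎ (x ∈ u × y ∈ v) ⊎ Before v x y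
Before-++⁻ []      p = inj₂ (inj₂ p)
Before-++⁻ (z ∷ u) (at-head m) with ∈-++⁻ u m
... | inj₁ y∈u = inj₁ (at-head y∈u)
... | inj₂ y∈v = inj₂ (inj₁ (here refl , y∈v))
Before-++⁻ (z ∷ u) (in-tail p) with Before-++⁻ u p
... | inj₁ q                 = inj₁ (in-tail q)
... | inj₂ (inj₁ (x∈u , y∈v)) = inj₂ (inj₁ (there x∈u , y∈v))
... | inj₂ (inj₂ q)          = inj₂ (inj₂ q)

unique-++ˡ : ∀ (u : Word) {v} → Unique (u ++ v) → Unique u
unique-++ˡ []      _           = []
unique-++ˡ (x ∷ u) (x∉ ∷ uuv) = AllP.++⁻ˡ u x∉ ∷ unique-++ˡ u uuv

unique-++ʳ : ∀ (u : Word) {v} → Unique (u ++ v) → Unique v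
unique-++ʳ []      uv         = uv
unique-++ʳ (x ∷ u) (_ ∷ uuv) = unique-++ʳ u uuv

unique-++-disjoint : ∀ (u : Word) {v x} → Unique (u ++ v) → x ∈ u → x ∉ v
unique-++-disjoint (z ∷ u) (z∉ ∷ _)  (here refl) x∈v = All¬⇒¬Any z∉ (∈-++⁺ʳ u x∈v)
unique-++-disjoint (z ∷ u) (_ ∷ uuv) (there x∈u) x∈v = unique-++-disjoint u uuv x∈u x∈v

++-injective : ∀ (u u' : Word) {v v'} → length u ≡ length u' → u ++ v ≡ u' ++ v' → u ≡ u' × v ≡ v'
++-injective []      []       _   e = refl , e
++-injective (x ∷ u) (x' ∷ u') len e with ∷-injective e
... | refl , e′ = Product.map₁ (cong (x ∷_)) (++-injective u u' (suc-injective len) e′)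

module _ {P : Pred ℕ 0ℓ} (P? : Decidable P) where

  Before-filter : ∀ {σ a b} → Before σ a b → P a → P b → Before (filter P? σ) a b
  Before-filter {a ∷ r} (at-head b∈r) Pa Pb with P? a
  ... | yes _  = at-head (∈-filter⁺ P? b∈r Pb)
  ... | no ¬Pa = ⊥-elim (¬Pa Pa)
  Before-filter {c ∷ r} (in-tail ab) Pa Pb with P? c
  ... | yes _ = in-tail (Before-filter ab Pa Pb)
  ... | no _  = Before-filter ab Pa Pb

  filter-partition : ∀ σ → Unique σ → (∀ {x y} → x ∈ σ → y ∈ σ → P x → ¬ P y → Before σ x y) →
    σ ≡ filter P? σ ++ filter (¬? ∘ P?) σ
  filter-partition []      _           _      = refl
  filter-partition (z ∷ r) (z∉r ∷ ur) sorted with P? z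
  ... | yes _  = cong (z ∷_) (filter-partition r ur sorted′)
    where
    sorted′ : ∀ {x y} → x ∈ r → y ∈ r → P x → ¬ P y → Before r x y
    sorted′ x∈ y∈ Px ¬Py with sorted (there x∈) (there y∈) Px ¬Py
    ... | at-head _  = ⊥-elim (All¬⇒¬Any z∉r x∈)
    ... | in-tail xy = xy
  ... | no ¬Pz = sym (cong₂ _++_ (filter-none P? none) (cong (z ∷_) (filter-all (¬? ∘ P?) none)))
    where
    before-z : ∀ {x} → Before (z ∷ r) x z → ⊥
    before-z (at-head z∈r) = All¬⇒¬Any z∉r z∈r
    before-z (in-tail xz)  = All¬⇒¬Any z∉r (Before-∈₂ xz)
    none : All (¬_ ∘ P) r
    none = All.tabulate λ x∈ Px → before-z (sorted (there x∈) (here refl) Px ¬Pz)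

V-length : ∀ w {σ} → σ ∈ V w → length σ ≡ length w
V-length w σ∈ = ↭-length (rearranges (proj₁ (V-sound w σ∈)))

exponent-split : ∀ c iA iB ia ib → iA ≤ ia → iB ≤ ib →
  (c + ia + ib) ∸ (iA + iB) ≡ c + ((ia ∸ iA) + (ib ∸ iB))
exponent-split c iA iB ia ib iA≤ia iB≤ib = begin
  (c + ia + ib) ∸ (iA + iB)
    ≡⟨ cong₂ (λ x y → (c + x + y) ∸ (iA + iB)) (m+[n∸m]≡n iA≤ia) (m+[n∸m]≡n iB≤ib) ⟨
  (c + (iA + (ia ∸ iA)) + (iB + (ib ∸ iB))) ∸ (iA + iB) ≡⟨ cong (_∸ (iA + iB)) (regroup c iA iB (ia ∸ iA) (ib ∸ iB)) ⟩
  ((iA + iB) + (c + ((ia ∸ iA) + (ib ∸ iB)))) ∸ (iA + iB) ≡⟨ m+n∸m≡n (iA + iB) _ ⟩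
  c + ((ia ∸ iA) + (ib ∸ iB))                           ∎
  where
  open ≡-Reasoning
  regroup : ∀ c iA iB da db → c + (iA + da) + (iB + db) ≡ (iA + iB) + (c + (da + db))
  regroup = solve-∀

module Blocks (A B : Word) (uAB : Unique (A ++ B)) where

  inA? : Decidable (_∈ A)
  inA? = _∈? A

  notA? : Decidable (_∉ A)
  notA? = ¬? ∘ inA?

  uA : Unique A
  uA = unique-++ˡ A uAB

  uB : Unique B
  uB = unique-++ʳ A uAB

  B∉A : ∀ {y} → y ∈ B → y ∉ A
  B∉A y∈B y∈A = unique-++-disjoint A uAB y∈A y∈B

  restrict-A : ∀ {σ} → (A ++ B) ≼ σ → A ≼ filter inA? σ
  restrict-A {σ} AB≼σ = ≼-intro rearr λ b<a ab →
    Before-filter inA? (keeps AB≼σ b<a (Before-++ˡ B ab)) (Before-∈₁ ab) (Before-∈₂ ab)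
    where
    rearr : filter inA? σ ↭ A
    rearr = begin
      filter inA? σ             ↭⟨ filter-↭ inA? (rearranges AB≼σ) ⟩
      filter inA? (A ++ B)      ≡⟨ filter-++ inA? A B ⟩
      filter inA? A ++ filter inA? B ≡⟨ cong₂ _++_ (filter-all inA? (All.tabulate id)) (filter-none inA? (All.tabulate B∉A)) ⟩
      A ++ []                   ≡⟨ ++-identityʳ A ⟩
      A                         ∎
      where open Perm.PermutationReasoning

  restrict-B : ∀ {σ} → (A ++ B) ≼ σ → B ≼ filter notA? σ
  restrict-B {σ} AB≼σ = ≼-intro rearr λ b<a ab →
    Before-filter notA? (keeps AB≼σ b<a (Before-++ʳ A ab)) (B∉A (Before-∈₁ ab)) (B∉A (Before-∈₂ ab))
    where
    rearr : filter notA? σ ↭ B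
    rearr = begin
      filter notA? σ                   ↭⟨ filter-↭ notA? (rearranges AB≼σ) ⟩
      filter notA? (A ++ B)            ≡⟨ filter-++ notA? A B ⟩
      filter notA? A ++ filter notA? B ≡⟨ cong₂ _++_ (filter-none notA? (All.tabulate λ x∈A x∉A → x∉A x∈A))
                                                     (filter-all notA? (All.tabulate B∉A)) ⟩
      B                                ∎
      where open Perm.PermutationReasoning

-- If every letter of A exceeds every letter of B, then V (A ++ B)
-- consists of the words a ++ b with a ∈ V A and b ∈ V B, and ℓ(a ++ b) =
-- |A||B| + ℓ(a) + ℓ(b); hence F(V_{A++B}) = F(V_A) F(V_B).
module SkewSum (A B : Word) (uAB : Unique (A ++ B)) (A>B : ∀ {x y} → x ∈ A → y ∈ B → y < x) where
  open Blocks A B uAB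

  ≼-skew-split : ∀ {σ} → (A ++ B) ≼ σ → σ ≡ filter inA? σ ++ filter notA? σ
  ≼-skew-split {σ} AB≼σ = filter-partition inA? σ (unique-resp-↭ (↭-sym (rearranges AB≼σ)) uAB) A-first
    where
    A-first : ∀ {x y} → x ∈ σ → y ∈ σ → x ∈ A → y ∉ A → Before σ x y
    A-first {x} {y} _ y∈σ x∈A y∉A with ∈-++⁻ A (∈-resp-↭ (rearranges AB≼σ) y∈σ)
    ... | inj₁ y∈A = ⊥-elim (y∉A y∈A)
    ... | inj₂ y∈B = keeps AB≼σ (A>B x∈A y∈B) (Before-across x∈A y∈B)

  ≼-++ : ∀ {a b} → A ≼ a → B ≼ b → (A ++ B) ≼ (a ++ b)
  ≼-++ {a} {b} A≼a B≼b = ≼-intro (++⁺ (rearranges A≼a) (rearranges B≼b)) keeps′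
    where
    keeps′ : ∀ {x y} → y < x → Before (A ++ B) x y → Before (a ++ b) x y
    keeps′ y<x xy with Before-++⁻ A xy
    ... | inj₁ xy∈A           = Before-++ˡ b (keeps A≼a y<x xy∈A)
    ... | inj₂ (inj₁ (x∈A , y∈B)) =
      Before-across (∈-resp-↭ (↭-sym (rearranges A≼a)) x∈A) (∈-resp-↭ (↭-sym (rearranges B≼b)) y∈B)
    ... | inj₂ (inj₂ xy∈B)    = Before-++ʳ a (keeps B≼b y<x xy∈B)

  pairs : List (Word × Word)
  pairs = cartesianProduct (V A) (V B)

  concat₂ : Word × Word → Word
  concat₂ (a , b) = a ++ b

  concat₂-injective : ∀ {p p'} → p ∈ pairs → p' ∈ pairs → concat₂ p ≡ concat₂ p' → p ≡ p'
  concat₂-injective {a , b} {a' , b'} p∈ p'∈ e =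
    let (a∈ , _) = ∈-cartesianProduct⁻ (V A) (V B) p∈
        (a'∈ , _) = ∈-cartesianProduct⁻ (V A) (V B) p'∈
        (a≡a' , b≡b') = ++-injective a a' (trans (V-length A a∈) (sym (V-length A a'∈))) e
    in cong₂ _,_ a≡a' b≡b'

  onto : ∀ {σ} → σ ∈ V (A ++ B) → σ ∈ map concat₂ pairs
  onto {σ} σ∈ = subst (_∈ map concat₂ pairs) (sym (≼-skew-split AB≼σ))
    (∈-map⁺ concat₂ (∈-cartesianProduct⁺ (V-complete A uA (restrict-A AB≼σ)) (V-complete B uB (restrict-B AB≼σ))))
    where
    AB≼σ : (A ++ B) ≼ σ
    AB≼σ = proj₁ (V-sound (A ++ B) σ∈)

  into : ∀ {p} → p ∈ pairs → concat₂ p ∈ V (A ++ B)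
  into p∈ = let (a∈ , b∈) = ∈-cartesianProduct⁻ (V A) (V B) p∈
            in V-complete (A ++ B) uAB (≼-++ (proj₁ (V-sound A a∈)) (proj₁ (V-sound B b∈)))

  -- The summand of a ++ b factors: the |A||B| crossing inversions cancel.
  weight-++ : ∀ {p} → p ∈ pairs → weight (A ++ B) (concat₂ p) ≈ (weight A (proj₁ p) *P weight B (proj₂ p))
  weight-++ {a , b} p∈ = ≈-trans (≡⇒≈ (cong qpow exponent)) (qpow-+ (inv a ∸ inv A) (inv b ∸ inv B))
    where
    a∈ : a ∈ V A
    a∈ = proj₁ (∈-cartesianProduct⁻ (V A) (V B) p∈)
    b∈ : b ∈ V B
    b∈ = proj₂ (∈-cartesianProduct⁻ (V A) (V B) p∈)
    A≼a : A ≼ a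
    A≼a = proj₁ (V-sound A a∈)
    B≼b : B ≼ b
    B≼b = proj₁ (V-sound B b∈)
    a>b : ∀ {x y} → x ∈ a → y ∈ b → y < x
    a>b x∈ y∈ = A>B (∈-resp-↭ (rearranges A≼a) x∈) (∈-resp-↭ (rearranges B≼b) y∈)
    X : ℕ
    X = length A * length B
    exponent : inv (a ++ b) ∸ inv (A ++ B) ≡ (inv a ∸ inv A) + (inv b ∸ inv B)
    exponent = begin
      inv (a ++ b) ∸ inv (A ++ B)                  ≡⟨ cong₂ _∸_ (inv-++ a b) (inv-++ A B) ⟩
      (cross a b + inv a + inv b) ∸ (cross A B + inv A + inv B)
        ≡⟨ cong₂ (λ c c' → (c + inv a + inv b) ∸ (c' + inv A + inv B))
                 (trans (cross-all a b a>b) (cong₂ _*_ (V-length A a∈) (V-length B b∈))) (cross-all A B A>B) ⟩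
      (X + inv a + inv b) ∸ (X + inv A + inv B)    ≡⟨ cong₂ _∸_ (+-assoc X (inv a) (inv b)) (+-assoc X (inv A) (inv B)) ⟩
      (X + (inv a + inv b)) ∸ (X + (inv A + inv B)) ≡⟨ [m+n]∸[m+o]≡n∸o X (inv a + inv b) (inv A + inv B) ⟩
      (inv a + inv b) ∸ (inv A + inv B)
        ≡⟨ exponent-split 0 (inv A) (inv B) (inv a) (inv b) (proj₂ (V-sound A a∈)) (proj₂ (V-sound B b∈)) ⟩
      (inv a ∸ inv A) + (inv b ∸ inv B)            ∎
      where open ≡-Reasoning

  Fperm-skew : Fperm (A ++ B) ≈ (Fperm A *P Fperm B)
  Fperm-skew = begin
    Fperm (A ++ B)
      ≈⟨ Fperm-reindex (A ++ B) concat₂ pairs (UP.cartesianProduct⁺ (V-unique A) (V-unique B)) concat₂-injective onto into ⟩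
    sumP (weight (A ++ B) ∘ concat₂) pairs
      ≈⟨ sumP-cong pairs weight-++ ⟩
    sumP (λ p → weight A (proj₁ p) *P weight B (proj₂ p)) pairs
      ≈⟨ sumP-cartesian (weight A) (weight B) (V A) (V B) ⟩
    Fperm A *P Fperm B ∎
    where open ≈-Reasoning

shuffle : List Bool → Word → Word → Word
shuffle []          a       b       = a ++ b
shuffle (false ∷ s) []      b       = shuffle s [] b
shuffle (false ∷ s) (x ∷ a) b       = x ∷ shuffle s a b
shuffle (true ∷ s)  a       []      = shuffle s a []
shuffle (true ∷ s)  a       (y ∷ b) = y ∷ shuffle s a b

shuffle-↭ : ∀ s a b → shuffle s a b ↭ a ++ b
shuffle-↭ []          a       b       = ↭-refl
shuffle-↭ (false ∷ s) []      b       = shuffle-↭ s [] b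
shuffle-↭ (false ∷ s) (x ∷ a) b       = prep x (shuffle-↭ s a b)
shuffle-↭ (true ∷ s)  a       []      = shuffle-↭ s a []
shuffle-↭ (true ∷ s)  a       (y ∷ b) = ↭-trans (prep y (shuffle-↭ s a b)) (↭-sym (shift y a b))

Before-shuffleˡ : ∀ s {a b x y} → Before a x y → Before (shuffle s a b) x y
Before-shuffleˡ []          {b = b}         xy          = Before-++ˡ b xy
Before-shuffleˡ (false ∷ s) {_ ∷ a} {b}     (at-head m) = at-head (∈-resp-↭ (↭-sym (shuffle-↭ s a b)) (∈-++⁺ˡ m))
Before-shuffleˡ (false ∷ s) {_ ∷ a}         (in-tail xy) = in-tail (Before-shuffleˡ s xy)
Before-shuffleˡ (true ∷ s)  {a} {[]}        xy          = Before-shuffleˡ s xy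
Before-shuffleˡ (true ∷ s)  {a} {_ ∷ b}     xy          = in-tail (Before-shuffleˡ s xy)

Before-shuffleʳ : ∀ s {a b x y} → Before b x y → Before (shuffle s a b) x y
Before-shuffleʳ []          {a}             xy          = Before-++ʳ a xy
Before-shuffleʳ (false ∷ s) {[]}            xy          = Before-shuffleʳ s xy
Before-shuffleʳ (false ∷ s) {_ ∷ a}         xy          = in-tail (Before-shuffleʳ s xy)
Before-shuffleʳ (true ∷ s)  {a} {_ ∷ b}     (at-head m) = at-head (∈-resp-↭ (↭-sym (shuffle-↭ s a b)) (∈-++⁺ʳ a m))
Before-shuffleʳ (true ∷ s)  {a} {_ ∷ b}     (in-tail xy) = in-tail (Before-shuffleʳ s xy)

data ShuffleCode : List Bool → ℕ → ℕ → Set where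
  done  : ShuffleCode [] 0 0
  left  : ∀ {s i j} → ShuffleCode s i j → ShuffleCode (false ∷ s) (suc i) j
  right : ∀ {s i j} → ShuffleCode s i j → ShuffleCode (true ∷ s) i (suc j)

shuffleCodes : ℕ → ℕ → List (List Bool)
shuffleCodes zero    zero    = [] ∷ []
shuffleCodes zero    (suc j) = map (true ∷_) (shuffleCodes zero j)
shuffleCodes (suc i) zero    = map (false ∷_) (shuffleCodes i zero)
shuffleCodes (suc i) (suc j) = map (false ∷_) (shuffleCodes i (suc j)) ++ map (true ∷_) (shuffleCodes (suc i) j)

shuffleCodes-sound : ∀ i j {s} → s ∈ shuffleCodes i j → ShuffleCode s i j
shuffleCodes-sound zero zero (here refl) = done
shuffleCodes-sound zero (suc j) s∈ with ∈-map⁻ (true ∷_) s∈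
... | _ , s∈′ , refl = right (shuffleCodes-sound zero j s∈′)
shuffleCodes-sound (suc i) zero s∈ with ∈-map⁻ (false ∷_) s∈
... | _ , s∈′ , refl = left (shuffleCodes-sound i zero s∈′)
shuffleCodes-sound (suc i) (suc j) s∈ with ∈-++⁻ (map (false ∷_) (shuffleCodes i (suc j))) s∈
... | inj₁ s∈ˡ with ∈-map⁻ (false ∷_) s∈ˡ
...   | _ , s∈′ , refl = left (shuffleCodes-sound i (suc j) s∈′)
shuffleCodes-sound (suc i) (suc j) s∈ | inj₂ s∈ʳ with ∈-map⁻ (true ∷_) s∈ʳ
...   | _ , s∈′ , refl = right (shuffleCodes-sound (suc i) j s∈′)

shuffleCodes-complete : ∀ {s i j} → ShuffleCode s i j → s ∈ shuffleCodes i j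
shuffleCodes-complete done = here refl
shuffleCodes-complete (left {j = zero} c)  = ∈-map⁺ (false ∷_) (shuffleCodes-complete c)
shuffleCodes-complete (left {j = suc j} c) = ∈-++⁺ˡ (∈-map⁺ (false ∷_) (shuffleCodes-complete c))
shuffleCodes-complete (right {i = zero} c)  = ∈-map⁺ (true ∷_) (shuffleCodes-complete c)
shuffleCodes-complete (right {i = suc i} {j} c) =
  ∈-++⁺ʳ (map (false ∷_) (shuffleCodes i (suc j))) (∈-map⁺ (true ∷_) (shuffleCodes-complete c))

shuffleCodes-unique : ∀ i j → Unique (shuffleCodes i j)
shuffleCodes-unique zero    zero    = [] ∷ []
shuffleCodes-unique zero    (suc j) = UP.map⁺ ∷-injectiveʳ (shuffleCodes-unique zero j)
shuffleCodes-unique (suc i) zero    = UP.map⁺ ∷-injectiveʳ (shuffleCodes-unique i zero)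
shuffleCodes-unique (suc i) (suc j) = UP.++⁺ (UP.map⁺ ∷-injectiveʳ (shuffleCodes-unique i (suc j)))
                                             (UP.map⁺ ∷-injectiveʳ (shuffleCodes-unique (suc i) j)) disjoint
  where
  disjoint : ∀ {s} → ¬ (s ∈ map (false ∷_) (shuffleCodes i (suc j)) × s ∈ map (true ∷_) (shuffleCodes (suc i) j))
  disjoint (s∈ˡ , s∈ʳ) with ∈-map⁻ (false ∷_) s∈ˡ | ∈-map⁻ (true ∷_) s∈ʳ
  ... | _ , _ , refl | _ , _ , ()

falses : List Bool → ℕ
falses []          = 0
falses (false ∷ s) = suc (falses s)
falses (true ∷ s)  = falses s

falses-code : ∀ {s i j} → ShuffleCode s i j → falses s ≡ i
falses-code done      = refl
falses-code (left c)  = cong suc (falses-code c)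
falses-code (right c) = falses-code c

-- crossings s: the pairs (true, later false) of s; these are the inversions of
-- shuffle s a b when every letter of a is below every letter of b.
crossings : List Bool → ℕ
crossings []          = 0
crossings (false ∷ s) = crossings s
crossings (true ∷ s)  = falses s + crossings s

-- Shuffles counted by crossings: the q-binomial coefficient [i+j choose i].
qbinom : ℕ → ℕ → Poly
qbinom i j = sumP (qpow ∘ crossings) (shuffleCodes i j)

qbinom-zeroˡ : ∀ j → qbinom zero j ≈ (1 ∷ [])
qbinom-zeroˡ zero    = ≈-refl
qbinom-zeroˡ (suc j) = begin
  sumP (qpow ∘ crossings) (map (true ∷_) (shuffleCodes zero j))  ≡⟨ sumP-map (qpow ∘ crossings) (true ∷_) (shuffleCodes zero j) ⟩
  sumP (λ s → qpow (falses s + crossings s)) (shuffleCodes zero j)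
    ≈⟨ sumP-cong (shuffleCodes zero j) (λ {s} s∈ →
         ≡⇒≈ (cong (λ f → qpow (f + crossings s)) (falses-code (shuffleCodes-sound zero j s∈)))) ⟩
  qbinom zero j                                                   ≈⟨ qbinom-zeroˡ j ⟩
  1 ∷ []                                                          ∎
  where open ≈-Reasoning

qbinom-zeroʳ : ∀ i → qbinom i zero ≈ (1 ∷ [])
qbinom-zeroʳ zero    = ≈-refl
qbinom-zeroʳ (suc i) = ≈-trans (≡⇒≈ (sumP-map (qpow ∘ crossings) (false ∷_) (shuffleCodes i zero))) (qbinom-zeroʳ i)

-- Pascal recurrence: split on whether a shuffle starts with a letter of the
-- first word; a leading letter of the second word crosses all i+1 letters of the first.
qbinom-pascal : ∀ i j → qbinom (suc i) (suc j) ≈ (qbinom i (suc j) +P (qpow (suc i) *P qbinom (suc i) j))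
qbinom-pascal i j = begin
  sumP f (map (false ∷_) L ++ map (true ∷_) M)                 ≈⟨ sumP-++ f (map (false ∷_) L) (map (true ∷_) M) ⟩
  sumP f (map (false ∷_) L) +P sumP f (map (true ∷_) M)        ≡⟨ cong₂ _+P_ (sumP-map f (false ∷_) L) (sumP-map f (true ∷_) M) ⟩
  qbinom i (suc j) +P sumP (λ s → qpow (falses s + crossings s)) M
    ≈⟨ +P-cong ≈-refl (sumP-cong M λ {s} s∈ →
         ≈-trans (≡⇒≈ (cong (λ f → qpow (f + crossings s)) (falses-code (shuffleCodes-sound (suc i) j s∈))))
                                                      (qpow-+ (suc i) (crossings s))) ⟩
  qbinom i (suc j) +P sumP (λ s → qpow (suc i) *P qpow (crossings s)) M
    ≈⟨ +P-cong ≈-refl (sumP-scale (qpow (suc i)) (qpow ∘ crossings) M) ⟩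
  qbinom i (suc j) +P (qpow (suc i) *P qbinom (suc i) j)       ∎
  where
  open ≈-Reasoning
  f = qpow ∘ crossings
  L = shuffleCodes i (suc j)
  M = shuffleCodes (suc i) j

-- [i]! [j]! · qbinom i j = [i+j]!, by induction along the Pascal recurrence and
-- [i+j+2] = [i+1] + q^(i+1) [j+1].
qbinom-factorial : ∀ i j → ((qfact i *P qfact j) *P qbinom i j) ≈ qfact (i + j)
qbinom-factorial zero j = begin
  ((1 ∷ []) *P qfact j) *P qbinom zero j   ≈⟨ *P-congʳ ((1 ∷ []) *P qfact j) (qbinom-zeroˡ j) ⟩
  ((1 ∷ []) *P qfact j) *P (1 ∷ [])        ≈⟨ *P-identityʳ _ ⟩
  (1 ∷ []) *P qfact j                      ≈⟨ *P-identityˡ (qfact j) ⟩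
  qfact j                                  ∎
  where open ≈-Reasoning
qbinom-factorial (suc i) zero = begin
  (qfact (suc i) *P (1 ∷ [])) *P qbinom (suc i) zero  ≈⟨ *P-congʳ (qfact (suc i) *P (1 ∷ [])) (qbinom-zeroʳ (suc i)) ⟩
  (qfact (suc i) *P (1 ∷ [])) *P (1 ∷ [])             ≈⟨ *P-identityʳ _ ⟩
  qfact (suc i) *P (1 ∷ [])                           ≈⟨ *P-identityʳ _ ⟩
  qfact (suc i)                                       ≡⟨ cong qfact (+-identityʳ (suc i)) ⟨
  qfact (suc i + zero)                                ∎
  where open ≈-Reasoning
qbinom-factorial (suc i) (suc j) = begin
  ((fi *P Ii) *P (fj *P Ij)) *P qbinom (suc i) (suc j)
    ≈⟨ *P-congʳ ((fi *P Ii) *P (fj *P Ij)) (qbinom-pascal i j) ⟩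
  ((fi *P Ii) *P (fj *P Ij)) *P (qbinom i (suc j) +P (Q *P qbinom (suc i) j))
    ≈⟨ expand fi Ii fj Ij Q (qbinom i (suc j)) (qbinom (suc i) j) ⟩
  (Ii *P ((fi *P (fj *P Ij)) *P qbinom i (suc j))) +P ((Q *P Ij) *P (((fi *P Ii) *P fj) *P qbinom (suc i) j))
    ≈⟨ +P-cong (*P-congʳ Ii (qbinom-factorial i (suc j)))
               (*P-congʳ (Q *P Ij) (≈-trans (qbinom-factorial (suc i) j) (≡⇒≈ (cong qfact (sym (+-suc i j)))))) ⟩
  (Ii *P qfact (i + suc j)) +P ((Q *P Ij) *P qfact (i + suc j))
    ≈⟨ collect Ii Q Ij (qfact (i + suc j)) ⟩
  qfact (i + suc j) *P (Ii +P (Q *P Ij))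
    ≈⟨ *P-congʳ (qfact (i + suc j)) (qint-+ (suc i) (suc j)) ⟨
  qfact (i + suc j) *P qint (suc i + suc j)   ∎
  where
  open ≈-Reasoning
  open PolySolver using (solve; _:+_; _:*_; _:=_)
  fi = qfact i
  fj = qfact j
  Ii = qint (suc i)
  Ij = qint (suc j)
  Q  = qpow (suc i)
  expand : ∀ fi Ii fj Ij Q g h → (((fi *P Ii) *P (fj *P Ij)) *P (g +P (Q *P h))) ≈
           ((Ii *P ((fi *P (fj *P Ij)) *P g)) +P ((Q *P Ij) *P (((fi *P Ii) *P fj) *P h)))
  expand = solve 7 (λ fi Ii fj Ij Q g h → ((fi :* Ii) :* (fj :* Ij)) :* (g :+ (Q :* h)) :=
           (Ii :* ((fi :* (fj :* Ij)) :* g)) :+ ((Q :* Ij) :* (((fi :* Ii) :* fj) :* h))) ≈-refl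
  collect : ∀ a b c F → ((a *P F) +P ((b *P c) *P F)) ≈ (F *P (a +P (b *P c)))
  collect = solve 4 (λ a b c F → (a :* F) :+ ((b :* c) :* F) := F :* (a :+ (b :* c))) ≈-refl

-- If every letter of A is below every letter of B, then V (A ++ B)
-- consists of the shuffles of words a ∈ V A and b ∈ V B, each obtained once,
-- and ℓ(shuffle s a b) = crossings s + ℓ(a) + ℓ(b).  Summing over shuffles gives
-- F(V_{A++B}) = qbinom |A| |B| · F(V_A) F(V_B).
module DirectSum (A B : Word) (uAB : Unique (A ++ B)) (A<B : ∀ {x y} → x ∈ A → y ∈ B → x < y) where
  open Blocks A B uAB

  tag : ℕ → Bool
  tag x = not (does (x ∈? A))

  tags : Word → List Bool
  tags = map tag

  shuffle-tags : ∀ σ → σ ≡ shuffle (tags σ) (filter inA? σ) (filter notA? σ)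
  shuffle-tags []      = refl
  shuffle-tags (z ∷ r) with z ∈? A
  ... | yes _ = cong (z ∷_) (shuffle-tags r)
  ... | no _  = cong (z ∷_) (shuffle-tags r)

  tags-code : ∀ σ → ShuffleCode (tags σ) (length (filter inA? σ)) (length (filter notA? σ))
  tags-code []      = done
  tags-code (z ∷ r) with z ∈? A
  ... | yes _ = left (tags-code r)
  ... | no _  = right (tags-code r)

  unshuffle : ∀ s a b → ShuffleCode s (length a) (length b) → (∀ {x} → x ∈ a → x ∈ A) → (∀ {y} → y ∈ b → y ∉ A) →
    tags (shuffle s a b) ≡ s × filter inA? (shuffle s a b) ≡ a × filter notA? (shuffle s a b) ≡ b
  unshuffle []          []      []      done      _   _   = refl , refl , refl
  unshuffle (false ∷ s) (x ∷ a) b       (left c)  a⊆A b∩A=∅ with x ∈? A | unshuffle s a b c (a⊆A ∘ there) b∩A=∅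
  ... | yes _   | s≡ , a≡ , b≡ = cong (false ∷_) s≡ , cong (x ∷_) a≡ , b≡
  ... | no x∉A  | _            = ⊥-elim (x∉A (a⊆A (here refl)))
  unshuffle (true ∷ s)  a       (y ∷ b) (right c) a⊆A b∩A=∅ with y ∈? A | unshuffle s a b c a⊆A (b∩A=∅ ∘ there)
  ... | yes y∈A | _            = ⊥-elim (b∩A=∅ (here refl) y∈A)
  ... | no _    | s≡ , a≡ , b≡ = cong (true ∷_) s≡ , a≡ , cong (y ∷_) b≡

  inv-shuffle : ∀ s a b → ShuffleCode s (length a) (length b) → (∀ {x y} → x ∈ a → y ∈ b → x < y) →
    inv (shuffle s a b) ≡ crossings s + inv a + inv b
  inv-shuffle []          []      []      done      a<b = refl
  inv-shuffle (false ∷ s) (x ∷ a) b       (left c)  a<b = begin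
    below x (shuffle s a b) + inv (shuffle s a b)
      ≡⟨ cong₂ _+_ (below-↭ x (shuffle-↭ s a b)) (inv-shuffle s a b c (a<b ∘ there)) ⟩
    below x (a ++ b) + (crossings s + inv a + inv b)    ≡⟨ cong (_+ (crossings s + inv a + inv b)) (below-++ x a b) ⟩
    (below x a + below x b) + (crossings s + inv a + inv b)
      ≡⟨ cong (λ t → (below x a + t) + (crossings s + inv a + inv b)) (below-none x b λ y∈b y<x → <-asym y<x (a<b (here refl) y∈b)) ⟩
    (below x a + 0) + (crossings s + inv a + inv b)     ≡⟨ regroup (below x a) (crossings s) (inv a) (inv b) ⟩
    crossings s + (below x a + inv a) + inv b           ∎
    where
    open ≡-Reasoning
    regroup : ∀ p c i j → (p + 0) + (c + i + j) ≡ c + (p + i) + j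
    regroup = solve-∀
  inv-shuffle (true ∷ s)  a       (y ∷ b) (right c) a<b = begin
    below y (shuffle s a b) + inv (shuffle s a b)
      ≡⟨ cong₂ _+_ (below-↭ y (shuffle-↭ s a b)) (inv-shuffle s a b c (λ x∈ y∈ → a<b x∈ (there y∈))) ⟩
    below y (a ++ b) + (crossings s + inv a + inv b)    ≡⟨ cong (_+ (crossings s + inv a + inv b)) (below-++ y a b) ⟩
    (below y a + below y b) + (crossings s + inv a + inv b)
      ≡⟨ cong (λ t → (t + below y b) + (crossings s + inv a + inv b)) (below-all y a λ x∈a → a<b x∈a (here refl)) ⟩
    (length a + below y b) + (crossings s + inv a + inv b) ≡⟨ regroup (length a) (below y b) (crossings s) (inv a) (inv b) ⟩
    length a + crossings s + inv a + (below y b + inv b) ≡⟨ cong (λ f → f + crossings s + inv a + (below y b + inv b)) (falses-code c) ⟨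
    falses s + crossings s + inv a + (below y b + inv b) ∎
    where
    open ≡-Reasoning
    regroup : ∀ l p c i j → (l + p) + (c + i + j) ≡ l + c + i + (p + j)
    regroup = solve-∀

  -- Shuffling words above A and above B gives a word above A ++ B, since no
  -- inversion of A ++ B straddles the two blocks.
  ≼-shuffle : ∀ s {a b} → A ≼ a → B ≼ b → (A ++ B) ≼ shuffle s a b
  ≼-shuffle s {a} {b} A≼a B≼b = ≼-intro (↭-trans (shuffle-↭ s a b) (++⁺ (rearranges A≼a) (rearranges B≼b))) keeps′
    where
    keeps′ : ∀ {x y} → y < x → Before (A ++ B) x y → Before (shuffle s a b) x y
    keeps′ y<x xy with Before-++⁻ A xy
    ... | inj₁ xy∈A               = Before-shuffleˡ s (keeps A≼a y<x xy∈A)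
    ... | inj₂ (inj₁ (x∈A , y∈B)) = ⊥-elim (<-asym y<x (A<B x∈A y∈B))
    ... | inj₂ (inj₂ xy∈B)        = Before-shuffleʳ s (keeps B≼b y<x xy∈B)

  triples : List (List Bool × Word × Word)
  triples = cartesianProduct (shuffleCodes (length A) (length B)) (cartesianProduct (V A) (V B))

  interleave : List Bool × Word × Word → Word
  interleave (s , a , b) = shuffle s a b

  record Admissible (s : List Bool) (a b : Word) : Set where
    field
      code  : ShuffleCode s (length a) (length b)
      A≼a   : A ≼ a
      B≼b   : B ≼ b
      ℓA≤ℓa : inv A ≤ inv a
      ℓB≤ℓb : inv B ≤ inv b

    a⊆A : ∀ {x} → x ∈ a → x ∈ A
    a⊆A = ∈-resp-↭ (rearranges A≼a)

    b∩A=∅ : ∀ {y} → y ∈ b → y ∉ A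
    b∩A=∅ = B∉A ∘ ∈-resp-↭ (rearranges B≼b)

  admissible : ∀ {s a b} → (s , a , b) ∈ triples → Admissible s a b
  admissible {s} {a} {b} t∈ =
    let (s∈ , ab∈) = ∈-cartesianProduct⁻ (shuffleCodes (length A) (length B)) (cartesianProduct (V A) (V B)) t∈
        (a∈ , b∈)  = ∈-cartesianProduct⁻ (V A) (V B) ab∈
    in record
      { code  = subst₂ (ShuffleCode s) (sym (V-length A a∈)) (sym (V-length B b∈)) (shuffleCodes-sound _ _ s∈)
      ; A≼a   = proj₁ (V-sound A a∈) ; B≼b = proj₁ (V-sound B b∈)
      ; ℓA≤ℓa = proj₂ (V-sound A a∈) ; ℓB≤ℓb = proj₂ (V-sound B b∈) }

  interleave-injective : ∀ {t t'} → t ∈ triples → t' ∈ triples → interleave t ≡ interleave t' → t ≡ t'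
  interleave-injective {s , a , b} {s' , a' , b'} t∈ t'∈ e =
    let open Admissible (admissible t∈)
        open Admissible (admissible t'∈) renaming (code to code′; a⊆A to a′⊆A; b∩A=∅ to b′∩A=∅)
        (s≡ , a≡ , b≡)    = unshuffle s a b code a⊆A b∩A=∅
        (s′≡ , a′≡ , b′≡) = unshuffle s' a' b' code′ a′⊆A b′∩A=∅
    in cong₂ _,_ (trans (sym s≡) (trans (cong tags e) s′≡))
                 (cong₂ _,_ (trans (sym a≡) (trans (cong (filter inA?) e) a′≡)) (trans (sym b≡) (trans (cong (filter notA?) e) b′≡)))

  onto : ∀ {σ} → σ ∈ V (A ++ B) → σ ∈ map interleave triples
  onto {σ} σ∈ = subst (_∈ map interleave triples) (sym (shuffle-tags σ))
    (∈-map⁺ interleave (∈-cartesianProduct⁺ s∈ (∈-cartesianProduct⁺ (V-complete A uA A≼a) (V-complete B uB B≼b))))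
    where
    AB≼σ : (A ++ B) ≼ σ
    AB≼σ = proj₁ (V-sound (A ++ B) σ∈)
    A≼a : A ≼ filter inA? σ
    A≼a = restrict-A AB≼σ
    B≼b : B ≼ filter notA? σ
    B≼b = restrict-B AB≼σ
    s∈ : tags σ ∈ shuffleCodes (length A) (length B)
    s∈ = shuffleCodes-complete (subst₂ (ShuffleCode (tags σ)) (↭-length (rearranges A≼a)) (↭-length (rearranges B≼b)) (tags-code σ))

  into : ∀ {t} → t ∈ triples → interleave t ∈ V (A ++ B)
  into {s , a , b} t∈ = V-complete (A ++ B) uAB (≼-shuffle s A≼a B≼b)
    where open Admissible (admissible t∈)

  weight-shuffle : ∀ {t} → t ∈ triples →
    weight (A ++ B) (interleave t) ≈ (qpow (crossings (proj₁ t)) *P (weight A (proj₁ (proj₂ t)) *P weight B (proj₂ (proj₂ t))))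
  weight-shuffle {s , a , b} t∈ = begin
    qpow (inv (shuffle s a b) ∸ inv (A ++ B))                     ≡⟨ cong qpow exponent ⟩
    qpow (crossings s + ((inv a ∸ inv A) + (inv b ∸ inv B)))      ≈⟨ qpow-+ (crossings s) _ ⟩
    qpow (crossings s) *P qpow ((inv a ∸ inv A) + (inv b ∸ inv B))
      ≈⟨ *P-congʳ (qpow (crossings s)) (qpow-+ (inv a ∸ inv A) (inv b ∸ inv B)) ⟩
    qpow (crossings s) *P (weight A a *P weight B b)              ∎
    where
    open ≈-Reasoning
    open Admissible (admissible t∈)
    a<b : ∀ {x y} → x ∈ a → y ∈ b → x < y
    a<b x∈ y∈ = A<B (a⊆A x∈) (∈-resp-↭ (rearranges B≼b) y∈)
    exponent : inv (shuffle s a b) ∸ inv (A ++ B) ≡ crossings s + ((inv a ∸ inv A) + (inv b ∸ inv B))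
    exponent = trans (cong₂ _∸_ (inv-shuffle s a b code a<b) (trans (inv-++ A B) (cong (λ c → c + inv A + inv B) (cross-none A B A<B))))
                     (exponent-split (crossings s) (inv A) (inv B) (inv a) (inv b) ℓA≤ℓa ℓB≤ℓb)

  Fperm-direct : Fperm (A ++ B) ≈ (qbinom (length A) (length B) *P (Fperm A *P Fperm B))
  Fperm-direct = begin
    Fperm (A ++ B)
      ≈⟨ Fperm-reindex (A ++ B) interleave triples
           (UP.cartesianProduct⁺ (shuffleCodes-unique (length A) (length B)) (UP.cartesianProduct⁺ (V-unique A) (V-unique B)))
           interleave-injective onto into ⟩
    sumP (weight (A ++ B) ∘ interleave) triples
      ≈⟨ sumP-cong triples weight-shuffle ⟩
    sumP (λ t → qpow (crossings (proj₁ t)) *P (weight A (proj₁ (proj₂ t)) *P weight B (proj₂ (proj₂ t)))) triples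
      ≈⟨ sumP-cartesian (qpow ∘ crossings) (λ ab → weight A (proj₁ ab) *P weight B (proj₂ ab))
           (shuffleCodes (length A) (length B)) (cartesianProduct (V A) (V B)) ⟩
    qbinom (length A) (length B) *P sumP (λ ab → weight A (proj₁ ab) *P weight B (proj₂ ab)) (cartesianProduct (V A) (V B))
      ≈⟨ *P-congʳ (qbinom (length A) (length B)) (sumP-cartesian (weight A) (weight B) (V A) (V B)) ⟩
    qbinom (length A) (length B) *P (Fperm A *P Fperm B)  ∎
    where open ≈-Reasoning

  Fperm-direct-factorial : ((qfact (length A) *P qfact (length B)) *P Fperm (A ++ B))
                         ≈ ((qfact (length A + length B) *P Fperm A) *P Fperm B)
  Fperm-direct-factorial = begin
    (fA *P fB) *P Fperm (A ++ B)                  ≈⟨ *P-congʳ (fA *P fB) Fperm-direct ⟩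
    (fA *P fB) *P (qbinom m k *P (FA *P FB))      ≈⟨ *P-assoc (fA *P fB) (qbinom m k) (FA *P FB) ⟨
    ((fA *P fB) *P qbinom m k) *P (FA *P FB)      ≈⟨ *P-congˡ (FA *P FB) (qbinom-factorial m k) ⟩
    qfact (m + k) *P (FA *P FB)                   ≈⟨ *P-assoc (qfact (m + k)) FA FB ⟨
    (qfact (m + k) *P FA) *P FB                   ∎
    where
    open ≈-Reasoning
    m = length A
    k = length B
    fA = qfact m
    fB = qfact k
    FA = Fperm A
    FB = Fperm B

-- Renaming the letters of w by a map g that is strictly increasing
-- on them is an isomorphism of the upper intervals preserving inversion numbers,
-- so F(V_{g∘w}) = F(V_w).  Standardisation is such a relabelling.
module Relabel (g : ℕ → ℕ) (w : Word) (uw : Unique w) (mono : ∀ {x y} → x ∈ w → y ∈ w → x < y → g x < g y) where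

  Sub : Word → Set
  Sub τ = ∀ {x} → x ∈ τ → x ∈ w

  reflects-< : ∀ {x y} → x ∈ w → y ∈ w → g x < g y → x < y
  reflects-< {x} {y} x∈ y∈ gx<gy with <-cmp x y
  ... | tri< x<y _ _ = x<y
  ... | tri≈ _ refl _ = ⊥-elim (<-irrefl refl gx<gy)
  ... | tri> _ _ y<x = ⊥-elim (<-asym gx<gy (mono y∈ x∈ y<x))

  g-injective : ∀ {x y} → x ∈ w → y ∈ w → g x ≡ g y → x ≡ y
  g-injective {x} {y} x∈ y∈ gx≡gy with <-cmp x y
  ... | tri< x<y _ _ = ⊥-elim (<-irrefl gx≡gy (mono x∈ y∈ x<y))
  ... | tri≈ _ x≡y _ = x≡y
  ... | tri> _ _ y<x = ⊥-elim (<-irrefl (sym gx≡gy) (mono y∈ x∈ y<x))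

  map-injective : ∀ τ τ' → Sub τ → Sub τ' → map g τ ≡ map g τ' → τ ≡ τ'
  map-injective []      []        _  _   _ = refl
  map-injective (x ∷ τ) (x' ∷ τ') s  s'  e with ∷-injective e
  ... | gx≡gx' , e′ =
    cong₂ _∷_ (g-injective (s (here refl)) (s' (here refl)) gx≡gx') (map-injective τ τ' (s ∘ there) (s' ∘ there) e′)

  Before-map⁺ : ∀ {τ a b} → Before τ a b → Before (map g τ) (g a) (g b)
  Before-map⁺ (at-head m)  = at-head (∈-map⁺ g m)
  Before-map⁺ (in-tail ab) = in-tail (Before-map⁺ ab)

  Before-map⁻ : ∀ {τ a' b'} → Before (map g τ) a' b' → Σ ℕ λ a → Σ ℕ λ b → a' ≡ g a × b' ≡ g b × Before τ a b
  Before-map⁻ {x ∷ τ} (at-head m) with ∈-map⁻ g m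
  ... | b , b∈ , refl = x , b , refl , refl , at-head b∈
  Before-map⁻ {x ∷ τ} (in-tail ab) with Before-map⁻ ab
  ... | a , b , e₁ , e₂ , ab′ = a , b , e₁ , e₂ , in-tail ab′

  ≼-map : ∀ {τ} → w ≼ τ → map g w ≼ map g τ
  ≼-map {τ} w≼τ = ≼-intro (map⁺ g (rearranges w≼τ)) keeps′
    where
    keeps′ : ∀ {a' b'} → b' < a' → Before (map g w) a' b' → Before (map g τ) a' b'
    keeps′ b'<a' ab with Before-map⁻ ab
    ... | a , b , refl , refl , ab′ = Before-map⁺ (keeps w≼τ (reflects-< (Before-∈₂ ab′) (Before-∈₁ ab′) b'<a') ab′)

  ≼-unmap : ∀ {σ} → map g w ≼ σ → Σ Word λ τ → σ ≡ map g τ × w ≼ τ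
  ≼-unmap {σ} gw≼σ with ↭-map-inv g (↭-sym (rearranges gw≼σ))
  ... | τ , refl , w↭τ = τ , refl , ≼-intro (↭-sym w↭τ) keeps′
    where
    keeps′ : ∀ {a b} → b < a → Before w a b → Before τ a b
    keeps′ b<a ab with Before-map⁻ (keeps gw≼σ (mono (Before-∈₂ ab) (Before-∈₁ ab) b<a) (Before-map⁺ ab))
    ... | a′ , b′ , e₁ , e₂ , ab′
      with g-injective (Before-∈₁ ab) (∈-resp-↭ (↭-sym w↭τ) (Before-∈₁ ab′)) e₁
         | g-injective (Before-∈₂ ab) (∈-resp-↭ (↭-sym w↭τ) (Before-∈₂ ab′)) e₂
    ...   | refl | refl = ab′

  below-map : ∀ x r → x ∈ w → Sub r → below (g x) (map g r) ≡ below x r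
  below-map x []      x∈ s = refl
  below-map x (y ∷ r) x∈ s with y <? x
  ... | yes y<x = begin
    below (g x) (g y ∷ map g r) ≡⟨ below-∷-< (map g r) (mono (s (here refl)) x∈ y<x) ⟩
    suc (below (g x) (map g r)) ≡⟨ cong suc (below-map x r x∈ (s ∘ there)) ⟩
    suc (below x r)             ≡⟨ below-∷-< r y<x ⟨
    below x (y ∷ r)             ∎
    where open ≡-Reasoning
  ... | no y≮x  = begin
    below (g x) (g y ∷ map g r) ≡⟨ below-∷-≮ (map g r) (y≮x ∘ reflects-< (s (here refl)) x∈) ⟩
    below (g x) (map g r)       ≡⟨ below-map x r x∈ (s ∘ there) ⟩
    below x r                   ≡⟨ below-∷-≮ r y≮x ⟨
    below x (y ∷ r)             ∎
    where open ≡-Reasoning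

  inv-map : ∀ τ → Sub τ → inv (map g τ) ≡ inv τ
  inv-map []      s = refl
  inv-map (x ∷ τ) s = cong₂ _+_ (below-map x τ (s (here refl)) (s ∘ there)) (inv-map τ (s ∘ there))

  V-Sub : ∀ {τ} → τ ∈ V w → Sub τ
  V-Sub τ∈ = ∈-resp-↭ (rearranges (proj₁ (V-sound w τ∈)))

  onto : ∀ {σ} → σ ∈ V (map g w) → σ ∈ map (map g) (V w)
  onto σ∈ with ≼-unmap (proj₁ (V-sound (map g w) σ∈))
  ... | τ , refl , w≼τ = ∈-map⁺ (map g) (V-complete w uw w≼τ)

  into : ∀ {τ} → τ ∈ V w → map g τ ∈ V (map g w)
  into τ∈ = V-complete (map g w) (unique-map g w uw g-injective) (≼-map (proj₁ (V-sound w τ∈)))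

  Fperm-relabel : Fperm (map g w) ≈ Fperm w
  Fperm-relabel = begin
    Fperm (map g w)                        ≈⟨ Fperm-reindex (map g w) (map g) (V w) (V-unique w)
                                                (λ τ∈ τ'∈ → map-injective _ _ (V-Sub τ∈) (V-Sub τ'∈)) onto into ⟩
    sumP (weight (map g w) ∘ map g) (V w)
      ≈⟨ sumP-cong (V w) (λ {τ} τ∈ → ≡⇒≈ (cong qpow (cong₂ _∸_ (inv-map τ (V-Sub τ∈)) (inv-map w id)))) ⟩
    Fperm w                                ∎
    where open ≈-Reasoning

below-[]-mono : ∀ {x y} z → x ≤ y → below x (z ∷ []) ≤ below y (z ∷ [])
below-[]-mono {x} {y} z x≤y = by-cases (z <? y)
  where
  by-cases : Dec (z < y) → below x (z ∷ []) ≤ below y (z ∷ [])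
  by-cases (yes z<y) = ≤-trans (length-filter (_<? x) (z ∷ [])) (≤-reflexive (sym (below-∷-< [] z<y)))
  by-cases (no z≮y)  = ≤-trans (≤-reflexive (below-∷-≮ [] λ z<x → z≮y (<-≤-trans z<x x≤y))) z≤n

below-mono : ∀ {x y} u → x ≤ y → below x u ≤ below y u
below-mono []      x≤y = z≤n
below-mono {x} {y} (z ∷ r) x≤y = begin
  below x (z ∷ r)               ≡⟨ below-++ x (z ∷ []) r ⟩
  below x (z ∷ []) + below x r  ≤⟨ +-mono-≤ (below-[]-mono z x≤y) (below-mono r x≤y) ⟩
  below y (z ∷ []) + below y r  ≡⟨ below-++ y (z ∷ []) r ⟨
  below y (z ∷ r)               ∎
  where open ≤-Reasoning

below-strict : ∀ {x y} u → x ∈ u → x < y → below x u < below y u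
below-strict {x} {y} (x ∷ r) (here refl) x<y = begin-strict
  below x (x ∷ r)               ≡⟨ below-++ x (x ∷ []) r ⟩
  below x (x ∷ []) + below x r  ≡⟨ cong (_+ below x r) (below-∷-≮ {x} [] (<-irrefl refl)) ⟩
  below x r                     <⟨ s≤s (below-mono r (<⇒≤ x<y)) ⟩
  suc (below y r)               ≡⟨ cong (_+ below y r) (below-∷-< [] x<y) ⟨
  below y (x ∷ []) + below y r  ≡⟨ below-++ y (x ∷ []) r ⟨
  below y (x ∷ r)               ∎
  where open ≤-Reasoning
below-strict {x} {y} (z ∷ r) (there x∈r) x<y = begin-strict
  below x (z ∷ r)               ≡⟨ below-++ x (z ∷ []) r ⟩
  below x (z ∷ []) + below x r  <⟨ +-mono-≤-< (below-[]-mono z (<⇒≤ x<y)) (below-strict r x∈r x<y) ⟩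
  below y (z ∷ []) + below y r  ≡⟨ below-++ y (z ∷ []) r ⟨
  below y (z ∷ r)               ∎
  where open ≤-Reasoning

-- F of a word with distinct letters equals F of the word itself: its
-- standardisation is the increasing relabelling x ↦ 1 + below x σ.
F≈Fperm : ∀ σ → Unique σ → F σ ≈ Fperm σ
F≈Fperm σ uσ = Relabel.Fperm-relabel (λ x → suc (below x σ)) σ uσ λ x∈ _ x<y → s≤s (below-strict σ x∈ x<y)

≤-suc-split : ∀ {i K} → i ≤ suc K → i ≤ K ⊎ i ≡ suc K
≤-suc-split i≤sK = Sum.map₁ ≤-pred (m≤n⇒m<n∨m≡n i≤sK)

last-satisfying : (P : ℕ → Set) → (∀ i → Dec (P i)) → P 0 → ∀ N →
  Σ ℕ λ K → K ≤ N × P K × (∀ i → K < i → i ≤ N → ¬ P i)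
last-satisfying P P? P0 zero = 0 , z≤n , P0 , λ i 0<i i≤0 → ⊥-elim (<⇒≱ 0<i i≤0)
last-satisfying P P? P0 (suc N) with P? (suc N)
... | yes PsN = suc N , ≤-refl , PsN , λ i sN<i i≤sN → ⊥-elim (<⇒≱ sN<i i≤sN)
... | no ¬PsN with last-satisfying P P? P0 N
...   | K , K≤N , PK , after = K , m≤n⇒m≤1+n K≤N , PK , λ i K<i i≤sN →
  [ after i K<i , (λ { refl → ¬PsN }) ] (≤-suc-split i≤sN)

argmax-upto : (f : ℕ → ℕ) → ∀ K → Σ ℕ λ q → q ≤ K × (∀ i → i ≤ K → f i ≤ f q)
argmax-upto f zero = 0 , z≤n , λ { i z≤n → ≤-refl }
argmax-upto f (suc K) with argmax-upto f K
... | q , q≤K , f≤fq with f q ≤? f (suc K)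
...   | yes fq≤ = suc K , ≤-refl , λ i i≤sK →
  [ (λ i≤K → ≤-trans (f≤fq i i≤K) fq≤) , (λ { refl → ≤-refl }) ] (≤-suc-split i≤sK)
...   | no fq≰  = q , m≤n⇒m≤1+n q≤K , λ i i≤sK →
  [ f≤fq i , (λ { refl → <⇒≤ (≰⇒> fq≰) }) ] (≤-suc-split i≤sK)

-- A sequence a 0, …, a n' of distinct numbers with a 0 < a n' either has a cut
-- K < n' with everything up to K below everything after K, or contains the
-- pattern 2413 at positions 0 < q < K < l.  Take K the last position with
-- a K ≤ a 0 and q a position of the maximum of a 0, …, a K: if some later
-- a l is below a q, then a K < a 0 < a l < a q.
module Sequence (n' : ℕ) (a : ℕ → ℕ) (inj : ∀ i j → i ≤ n' → j ≤ n' → a i ≡ a j → i ≡ j) (a0<an' : a 0 < a n') where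

  Cut : Set
  Cut = Σ ℕ λ K → K < n' × (∀ i l → i ≤ K → K < l → l ≤ n' → a i < a l)

  Pattern2413 : Set
  Pattern2413 = Σ ℕ λ q → Σ ℕ λ K → Σ ℕ λ l →
    0 < q × q < K × K < l × l ≤ n' × a K < a 0 × a 0 < a l × a l < a q

  lastLow : Σ ℕ λ K → K ≤ n' × a K ≤ a 0 × (∀ i → K < i → i ≤ n' → ¬ a i ≤ a 0)
  lastLow = last-satisfying (λ i → a i ≤ a 0) (λ i → a i ≤? a 0) ≤-refl n'

  K : ℕ
  K = proj₁ lastLow

  K≤n' : K ≤ n'
  K≤n' = proj₁ (proj₂ lastLow)

  aK≤a0 : a K ≤ a 0
  aK≤a0 = proj₁ (proj₂ (proj₂ lastLow))

  a0<after-K : ∀ l → K < l → l ≤ n' → a 0 < a l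
  a0<after-K l K<l l≤n' = ≰⇒> (proj₂ (proj₂ (proj₂ lastLow)) l K<l l≤n')

  K<n' : K < n'
  K<n' with m≤n⇒m<n∨m≡n K≤n'
  ... | inj₁ K<n' = K<n'
  ... | inj₂ K≡n' = ⊥-elim (<⇒≱ a0<an' (subst (λ j → a j ≤ a 0) K≡n' aK≤a0))

  top : Σ ℕ λ q → q ≤ K × (∀ i → i ≤ K → a i ≤ a q)
  top = argmax-upto a K

  q : ℕ
  q = proj₁ top

  q≤K : q ≤ K
  q≤K = proj₁ (proj₂ top)

  ≤aq : ∀ i → i ≤ K → a i ≤ a q
  ≤aq = proj₂ (proj₂ top)

  found-2413 : ∀ l → K < l → l ≤ n' → a l < a q → Pattern2413
  found-2413 l K<l l≤n' al<aq = q , K , l , 0<q , q<K , K<l , l≤n' , aK<a0 , a0<al , al<aq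
    where
    a0<al : a 0 < a l
    a0<al = a0<after-K l K<l l≤n'
    a0<aq : a 0 < a q
    a0<aq = <-trans a0<al al<aq
    positive : ∀ j → a 0 < a j → 0 < j
    positive zero    a0<a0 = ⊥-elim (<-irrefl refl a0<a0)
    positive (suc _) _     = s≤s z≤n
    0<q : 0 < q
    0<q = positive q a0<aq
    aK<a0 : a K < a 0
    aK<a0 with m≤n⇒m<n∨m≡n aK≤a0
    ... | inj₁ aK<a0 = aK<a0
    ... | inj₂ aK≡a0 = ⊥-elim (<⇒≱ 0<q (subst (q ≤_) (inj K 0 K≤n' z≤n aK≡a0) q≤K))
    q<K : q < K
    q<K with m≤n⇒m<n∨m≡n q≤K
    ... | inj₁ q<K = q<K
    ... | inj₂ q≡K = ⊥-elim (<-asym aK<a0 (subst (λ j → a 0 < a j) q≡K a0<aq))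

  cut : (∀ l → K < l → l ≤ n' → ¬ a l < a q) → Cut
  cut none-below = K , K<n' , λ i l i≤K K<l l≤n' → ≤-<-trans (≤aq i i≤K) (aq<al l K<l l≤n')
    where
    aq<al : ∀ l → K < l → l ≤ n' → a q < a l
    aq<al l K<l l≤n' with <-cmp (a q) (a l)
    ... | tri< aq<al _ _ = aq<al
    ... | tri≈ _ aq≡al _ = ⊥-elim (<⇒≢ (≤-<-trans q≤K K<l) (inj q l (≤-trans q≤K K≤n') l≤n' aq≡al))
    ... | tri> _ _ al<aq = ⊥-elim (none-below l K<l l≤n' al<aq)

  cut-or-2413 : Cut ⊎ Pattern2413
  cut-or-2413 with anyUpTo? (λ l → (K <? l) ×-dec (a l <? a q)) (suc n')
  ... | yes (l , l<sn' , K<l , al<aq) = inj₂ (found-2413 l K<l (≤-pred l<sn') al<aq)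
  ... | no ¬pattern = inj₁ (cut λ l K<l l≤n' al<aq → ¬pattern (l , s≤s l≤n' , K<l , al<aq))

-- The letter of a word at position i (0 past the end).
letter : Word → ℕ → ℕ
letter []      i       = 0
letter (x ∷ r) zero    = x
letter (x ∷ r) (suc i) = letter r i

letter-∈ : ∀ π {i} → i < length π → letter π i ∈ π
letter-∈ (x ∷ r) {zero}  _ = here refl
letter-∈ (x ∷ r) {suc i} i<len = there (letter-∈ r (≤-pred i<len))

letter-injective : ∀ π → Unique π → ∀ i j → i < length π → j < length π → letter π i ≡ letter π j → i ≡ j
letter-injective (x ∷ r) _           zero    zero    _ _ _ = refl
letter-injective (x ∷ r) (x∉r ∷ _)  zero    (suc j) _ j< e = ⊥-elim (All¬⇒¬Any x∉r (subst (_∈ r) (sym e) (letter-∈ r (≤-pred j<))))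
letter-injective (x ∷ r) (x∉r ∷ _)  (suc i) zero    i< _ e = ⊥-elim (All¬⇒¬Any x∉r (subst (_∈ r) e (letter-∈ r (≤-pred i<))))
letter-injective (x ∷ r) (_ ∷ ur)   (suc i) (suc j) i< j< e = cong suc (letter-injective r ur i j (≤-pred i<) (≤-pred j<) e)

lookup-letter : ∀ π (f : Fin (length π)) → lookup π f ≡ letter π (toℕ f)
lookup-letter (x ∷ r) Fin.zero    = refl
lookup-letter (x ∷ r) (Fin.suc f) = lookup-letter r f

final-letter : ∀ x r → final (x ∷ r) ≡ letter (x ∷ r) (length r)
final-letter x []      = refl
final-letter x (y ∷ r) = final-letter y r

take-letter : ∀ m π {x} → x ∈ take m π → Σ ℕ λ i → i < m × i < length π × x ≡ letter π i
take-letter (suc m) (y ∷ r) (here refl) = 0 , s≤s z≤n , s≤s z≤n , refl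
take-letter (suc m) (y ∷ r) (there x∈) with take-letter m r x∈
... | i , i<m , i<len , x≡ = suc i , s≤s i<m , s≤s i<len , x≡

drop-letter : ∀ m π {y} → y ∈ drop m π → Σ ℕ λ j → m ≤ j × j < length π × y ≡ letter π j
drop-letter zero    (z ∷ r) (here refl) = 0 , z≤n , s≤s z≤n , refl
drop-letter zero    (z ∷ r) (there y∈) with drop-letter zero r y∈
... | j , _ , j<len , y≡ = suc j , z≤n , s≤s j<len , y≡
drop-letter (suc m) (z ∷ r) y∈ with drop-letter m r y∈
... | j , m≤j , j<len , y≡ = suc j , s≤s m≤j , s≤s j<len , y≡

module Occurrence (π : Word) {i j k h : ℕ} (i< : i < length π) (j< : j < length π) (k< : k < length π) (h< : h < length π)
                  (i<j : i < j) (j<k : j < k) (k<h : k < h) where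

  private
    pos : ∀ {p} → p < length π → Fin (length π)
    pos p< = fromℕ< p<
    val : ∀ {p} (p< : p < length π) → lookup π (pos p<) ≡ letter π p
    val p< = trans (lookup-letter π (fromℕ< p<)) (cong (letter π) (toℕ-fromℕ< p<))
    order : ∀ {p p'} (p< : p < length π) (p'< : p' < length π) → p < p' → pos p< Fin.< pos p'<
    order p< p'< = subst₂ _<_ (sym (toℕ-fromℕ< p<)) (sym (toℕ-fromℕ< p'<))
    lt : ∀ {p p'} (p< : p < length π) (p'< : p' < length π) → letter π p < letter π p' → lookup π (pos p<) < lookup π (pos p'<)
    lt p< p'< = subst₂ _<_ (sym (val p<)) (sym (val p'<))

  occurrence-2413 : letter π k < letter π i → letter π i < letter π h → letter π h < letter π j → Contains2413 π
  occurrence-2413 ki ih hj = pos i< , pos j< , pos k< , pos h< , order i< j< i<j , order j< k< j<k , order k< h< k<h ,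
    lt k< i< ki , lt i< h< ih , lt h< j< hj

  occurrence-3142 : letter π j < letter π h → letter π h < letter π i → letter π i < letter π k → Contains3142 π
  occurrence-3142 jh hi ik = pos i< , pos j< , pos k< , pos h< , order i< j< i<j , order j< k< j<k , order k< h< k<h ,
    lt j< h< jh , lt h< i< hi , lt i< k< ik

cut-blocks : ∀ (R : ℕ → ℕ → Set) π K → (∀ i l → i ≤ K → K < l → l < length π → R (letter π i) (letter π l)) →
  ∀ {a b} → a ∈ take (suc K) π → b ∈ drop (suc K) π → R a b
cut-blocks R π K separated a∈ b∈ with take-letter (suc K) π a∈ | drop-letter (suc K) π b∈
... | i , i<sK , _ , refl | l , sK≤l , l<len , refl = separated i l (≤-pred i<sK) sK≤l l<len

letter≤max : ∀ π {i} → i < length π → letter π i ≤ max 0 π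
letter≤max π i< = All.lookup (xs≤max 0 π) (letter-∈ π i<)

CutBy : (ℕ → ℕ → Set) → Word → Set
CutBy R π = Σ ℕ λ m → 1 ≤ m × m < length π × (∀ {a b} → a ∈ take m π → b ∈ drop m π → R a b)

direct-cut : ∀ x r → Unique (x ∷ r) → ¬ Contains2413 (x ∷ r) → x < final (x ∷ r) → CutBy _<_ (x ∷ r)
direct-cut x r uπ avoid x<final = [ from-cut , from-2413 ] S.cut-or-2413
  where
  π = x ∷ r
  module S = Sequence (length r) (letter π) (λ i j i≤ j≤ → letter-injective π uπ i j (s≤s i≤) (s≤s j≤))
                      (subst (x <_) (final-letter x r) x<final)
  from-cut : S.Cut → CutBy _<_ π
  from-cut (K , K<n' , low<high) =
    suc K , s≤s z≤n , s≤s K<n' , λ {a} {b} →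
      cut-blocks _<_ π K (λ i l i≤K K<l l<len → low<high i l i≤K K<l (≤-pred l<len)) {a} {b}
  from-2413 : S.Pattern2413 → CutBy _<_ π
  from-2413 (q , K , l , 0<q , q<K , K<l , l≤n' , aK<a0 , a0<al , al<aq) =
    ⊥-elim (avoid (Occurrence.occurrence-2413 π (s≤s z≤n) (s≤s (≤-trans (<⇒≤ (<-trans q<K K<l)) l≤n'))
                    (s≤s (≤-trans (<⇒≤ K<l) l≤n')) (s≤s l≤n') 0<q q<K K<l aK<a0 a0<al al<aq))

∸-reverses-< : ∀ N {x y} → x ≤ N → y ≤ N → N ∸ x < N ∸ y → y < x
∸-reverses-< N {x} {y} x≤N y≤N lt with y <? x
... | yes y<x = y<x
... | no y≮x  = ⊥-elim (<⇒≱ lt (∸-monoʳ-≤ N (≮⇒≥ y≮x)))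

-- Complementing the letters below a bound N reduces it to the sequence lemma.
skew-cut : ∀ x r N → (∀ i → i ≤ length r → letter (x ∷ r) i ≤ N) →
  Unique (x ∷ r) → ¬ Contains3142 (x ∷ r) → final (x ∷ r) < x → CutBy (λ a b → b < a) (x ∷ r)
skew-cut x r N ≤N uπ avoid final<x = [ from-cut , from-3142 ] S.cut-or-2413
  where
  π = x ∷ r
  complement : ℕ → ℕ
  complement i = N ∸ letter π i
  complement-injective : ∀ i j → i ≤ length r → j ≤ length r → complement i ≡ complement j → i ≡ j
  complement-injective i j i≤ j≤ e = letter-injective π uπ i j (s≤s i≤) (s≤s j≤)
    (trans (sym (m∸[m∸n]≡n (≤N i i≤))) (trans (cong (N ∸_) e) (m∸[m∸n]≡n (≤N j j≤))))
  reverse : ∀ i j → i ≤ length r → j ≤ length r → complement j < complement i → letter π i < letter π j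
  reverse i j i≤ j≤ = ∸-reverses-< N (≤N j j≤) (≤N i i≤)
  module S = Sequence (length r) complement complement-injective
                      (∸-monoʳ-< (subst (_< x) (final-letter x r) final<x) (≤N 0 z≤n))
  from-cut : S.Cut → CutBy (λ a b → b < a) π
  from-cut (K , K<n' , low<high) =
    suc K , s≤s z≤n , s≤s K<n' , λ {a} {b} → cut-blocks (λ a b → b < a) π K (λ i l i≤K K<l l<len →
      reverse l i (≤-pred l<len) (≤-trans i≤K (≤-trans (<⇒≤ K<l) (≤-pred l<len))) (low<high i l i≤K K<l (≤-pred l<len))) {a} {b}
  from-3142 : S.Pattern2413 → CutBy (λ a b → b < a) π
  from-3142 (q , K , l , 0<q , q<K , K<l , l≤n' , cK<c0 , c0<cl , cl<cq) =
    ⊥-elim (avoid (Occurrence.occurrence-3142 π (s≤s z≤n) (s≤s q≤n') (s≤s K≤n') (s≤s l≤n') 0<q q<K K<l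
      (reverse q l q≤n' l≤n' cl<cq) (reverse l 0 l≤n' z≤n c0<cl) (reverse 0 K z≤n K≤n' cK<c0)))
    where
    K≤n' : K ≤ length r
    K≤n' = ≤-trans (<⇒≤ K<l) l≤n'
    q≤n' : q ≤ length r
    q≤n' = ≤-trans (<⇒≤ q<K) K≤n'

F≈Fperm-split : ∀ π m → Unique π → F π ≈ Fperm (take m π ++ drop m π)
F≈Fperm-split π m uπ = ≈-trans (F≈Fperm π uπ) (≡⇒≈ (cong Fperm (sym (take++drop≡id m π))))

direct-identity : ∀ π m → Unique π → m ≤ length π → (∀ {a b} → a ∈ take m π → b ∈ drop m π → a < b) →
  ((qfact m *P qfact (length π ∸ m)) *P F π) ≈ ((qfact (length π) *P F (take m π)) *P F (drop m π))
direct-identity π m uπ m≤len A<B = begin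
  (qfact m *P qfact (length π ∸ m)) *P F π       ≡⟨ cong₂ (λ i j → (qfact i *P qfact j) *P F π) (sym lenA) (sym lenB) ⟩
  (qfact (length A) *P qfact (length B)) *P F π  ≈⟨ *P-congʳ (qfact (length A) *P qfact (length B)) (F≈Fperm-split π m uπ) ⟩
  (qfact (length A) *P qfact (length B)) *P Fperm (A ++ B)
                                                 ≈⟨ DirectSum.Fperm-direct-factorial A B uAB A<B ⟩
  (qfact (length A + length B) *P Fperm A) *P Fperm B
                                                 ≈⟨ *P-cong (*P-cong (≡⇒≈ (cong qfact lenAB)) (≈-sym (F≈Fperm A (unique-++ˡ A uAB))))
                                                            (≈-sym (F≈Fperm B (unique-++ʳ A uAB))) ⟩
  (qfact (length π) *P F A) *P F B               ∎
  where
  open ≈-Reasoning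
  A = take m π
  B = drop m π
  uAB : Unique (A ++ B)
  uAB = subst Unique (sym (take++drop≡id m π)) uπ
  lenA : length A ≡ m
  lenA = trans (length-take m π) (m≤n⇒m⊓n≡m m≤len)
  lenB : length B ≡ length π ∸ m
  lenB = length-drop m π
  lenAB : length A + length B ≡ length π
  lenAB = trans (cong₂ _+_ lenA lenB) (m+[n∸m]≡n m≤len)

skew-identity : ∀ π m → Unique π → (∀ {a b} → a ∈ take m π → b ∈ drop m π → b < a) →
  F π ≈ (F (take m π) *P F (drop m π))
skew-identity π m uπ A>B = begin
  F π                      ≈⟨ F≈Fperm-split π m uπ ⟩
  Fperm (A ++ B)           ≈⟨ SkewSum.Fperm-skew A B uAB A>B ⟩
  Fperm A *P Fperm B       ≈⟨ *P-cong (F≈Fperm A (unique-++ˡ A uAB)) (F≈Fperm B (unique-++ʳ A uAB)) ⟨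
  F A *P F B               ∎
  where
  open ≈-Reasoning
  A = take m π
  B = drop m π
  uAB : Unique (A ++ B)
  uAB = subst Unique (sym (take++drop≡id m π)) uπ

DirectConclusion : ℕ → Word → Set
DirectConclusion n π = Σ ℕ λ m → 1 ≤ m × m < n ×
  ((qfact m *P qfact (n ∸ m)) *P F π) ≈P ((qfact n *P F (take m π)) *P F (drop m π))

SkewConclusion : ℕ → Word → Set
SkewConclusion n π = Σ ℕ λ m → 1 ≤ m × m < n × F π ≈P (F (take m π) *P F (drop m π))

Conclusion : ℕ → Word → Set
Conclusion n π = (first π < final π → DirectConclusion n π) × (first π > final π → SkewConclusion n π)

separable-split : ∀ π → Unique π → Separable π → Conclusion (length π) π
separable-split []      _  _                       = (λ ()) , (λ ())
separable-split (x ∷ r) uπ (avoid3142 , avoid2413) =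
  direct ∘ direct-cut x r uπ avoid2413 , skew ∘ skew-cut x r N ≤N uπ avoid3142
  where
  π = x ∷ r
  N = max 0 π
  ≤N : ∀ i → i ≤ length r → letter π i ≤ N
  ≤N i i≤ = letter≤max π (s≤s i≤)
  direct : CutBy _<_ π → DirectConclusion (length π) π
  direct (m , 1≤m , m<len , A<B) = m , 1≤m , m<len , coeff-≡ (direct-identity π m uπ (<⇒≤ m<len) A<B)
  skew : CutBy (λ a b → b < a) π → SkewConclusion (length π) π
  skew (m , 1≤m , m<len , A>B) = m , 1≤m , m<len , coeff-≡ (skew-identity π m uπ A>B)

-- A permutation of 1, …, n has distinct letters and length n.
proposition2p5 : (n : ℕ) (π : Word) → 2 ≤ n → IsPerm n π → Separable π →
    (first π < final π →
      Σ ℕ λ m → 1 ≤ m × m < n ×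
        ((qfact m *P qfact (n ∸ m)) *P F π)
          ≈P ((qfact n *P F (take m π)) *P F (drop m π)))
  × (first π > final π →
      Σ ℕ λ m → 1 ≤ m × m < n ×
        F π ≈P (F (take m π) *P F (drop m π)))
proposition2p5 n π _ π↭1⋯n sep = subst (λ k → Conclusion k π) length≡n (separable-split π distinct sep)
  where
  distinct : Unique π
  distinct = unique-resp-↭ (↭-sym π↭1⋯n) (UP.map⁺ suc-injective (UP.upTo⁺ n))
  length≡n : length π ≡ n
  length≡n = trans (↭-length π↭1⋯n) (trans (length-map suc (upTo n)) (length-upTo n))
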